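{- Let $k$ be a prime and let $0\le i\le k-2$. Then for every non-negative integer $n$ and every positive integer $m$, the expression $$ \begin{bmatrix} nk+i\\ mk-1\end{bmatrix}\,\frac{[k]_{q^{m-1}}[k]_{q^{m-2}}\cdots[k]_{q}}{[k]_{q^{n}}[k]_{q^{n-1}}\cdots[k]_{q^{n-m+1}}} $$ is a polynomial in $q$.
   Context: $[j]=[j]_q=1+q+\cdots+q^{j-1}$ and $[k]_{q^a}=1+q^a+q^{2a}+\cdots+q^{(k-1)a}$; $[j]!=[j][j-1]\cdots[1]$, and $\begin{bmatrix} N\\ j\end{bmatrix}=\frac{[N]!}{[j]![N-j]!}$ for $0\le j\le N$, and $0$ if $j>N$. -}

module Defs where

open import Data.Nat as ℕ using (ℕ; zero; suc; _∸_; _≤?_)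
open import Data.Integer as ℤ using (ℤ; +_; -[1+_])
open import Data.List using (List; []; _∷_; map; foldr; replicate)
open import Relation.Nullary using (yes; no)
open import Relation.Binary.PropositionalEquality using (_≡_)

-- Polynomials in q with integer coefficients, as coefficient lists
-- (constant term first). Trailing zeros allowed; equality is coefficientwise.
Poly : Set
Poly = List ℤ

coeff : Poly → ℕ → ℤ
coeff []       _       = + 0
coeff (a ∷ p)  zero    = a
coeff (a ∷ p)  (suc d) = coeff p d

infix 4 _≈P_
_≈P_ : Poly → Poly → Set
p ≈P r = ∀ d → coeff p d ≡ coeff r d

infixl 6 _+P_
_+P_ : Poly → Poly → Poly
[]      +P r       = r
p       +P []      = p
(a ∷ p) +P (b ∷ r) = (a ℤ.+ b) ∷ (p +P r)

scale : ℤ → Poly → Poly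
scale c = map (c ℤ.*_)

infixl 7 _*P_
_*P_ : Poly → Poly → Poly
[]      *P r = []
(a ∷ p) *P r = scale a r +P (+ 0 ∷ (p *P r))

constP : ℤ → Poly
constP c = c ∷ []

oneP : Poly
oneP = constP (+ 1)

zeroP : Poly
zeroP = []

monoP : ℕ → Poly
monoP e = replicate e (+ 0) Data.List.++ (+ 1 ∷ [])
  where import Data.List

prodP : List Poly → Poly
prodP = foldr _*P_ oneP

-- [j]_{q^a} = 1 + q^a + q^{2a} + ... + q^{(j-1)a}
qintPow : ℕ → ℕ → Poly
qintPow a zero    = zeroP
qintPow a (suc j) = qintPow a j +P monoP (a ℕ.* j)

qint : ℕ → Poly
qint = qintPow 1

qfact : ℕ → Poly
qfact zero    = oneP
qfact (suc j) = qint (suc j) *P qfact j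

-- The Gaussian binomial [N choose j] = [N]!/([j]![N-j]!) for j ≤ N, 0 for j > N,
-- represented as a pair (numerator, denominator) of polynomials.
qbinomNum : ℕ → ℕ → Poly
qbinomNum N j with j ≤? N
... | yes _ = qfact N
... | no  _ = zeroP

qbinomDen : ℕ → ℕ → Poly
qbinomDen N j with j ≤? N
... | yes _ = qfact j *P qfact (N ∸ j)
... | no  _ = oneP

-- For e = -t < 0, [k]_{q^{-t}} = q^{-t(k-1)} [k]_{q^t}; we use [k]_{q^t},
-- which differs by the unit q^{-t(k-1)} of the Laurent ring.
qkZ : ℕ → ℤ → Poly
qkZ k (+ e)      = qintPow e k
qkZ k -[1+ t ]   = qintPow (suc t) k

upperProd : ℕ → ℕ → Poly
upperProd k m = prodP (go (m ∸ 1))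
  where
  go : ℕ → List Poly
  go zero    = []
  go (suc t) = qintPow (suc t) k ∷ go t

lowerProd : ℕ → ℕ → ℕ → Poly
lowerProd k n m = prodP (go m)
  where
  go : ℕ → List Poly
  go zero    = []
  go (suc s) = qkZ k (+ n ℤ.- + s) ∷ go s

IsPolyQuotient : Poly → Poly → Set
IsPolyQuotient numer denom = Data.Product.∃ λ (P : Poly) → P *P denom ≈P numer
  where import Data.Product

-- Write N = n k + i and r = m k - 1; if r > N the Gaussian binomial vanishes, and r ≤ N forces m ≤ n.
-- Multiplying numerator and denominator by ∏_{j<m} [j] · ∏_{n-m<j≤n} [j] and using [k]_{q^j} [j] = [j k]
-- turns the expression into a quotient of products of q-integers,
--   [N]! ∏_{j<m} [j k] ∏_{n-m<j≤n} [j]   over   [r]! [N-r]! ∏_{n-m<j≤n} [j k] ∏_{j<m} [j].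
-- As [e] is the product of the cyclotomic polynomials Φ_f over the divisors f of e, this is a polynomial
-- as soon as each f has at most as many multiples among the denominator factors as among the numerator
-- factors. For k ∤ f (k is prime) this is ⌊r/f⌋ + ⌊(N-r)/f⌋ ≤ ⌊N/f⌋. For f = e k, since N = n k + i,
-- r = (m-1) k + (k-1) and N - r = (n-m) k + (i+1) all have remainders below k, it reduces to
-- ⌊(m-1)/f⌋ being at most the number of multiples of f in (n-m, n].
-- The Φ_f are built inductively as exact quotients of [f]. They are pairwise coprime over ℚ because
-- [gcd e f] is a ℤ[q]-combination of [e] and [f], and Gauss's lemma clears the integer denominators.

module Submission where

open import Defs
open import Data.Nat as ℕ using (ℕ; zero; suc; _+_; _*_; _∸_; _≤_; _<_; _/_; _%_; NonZero; s≤s; z≤n; _≟_)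
import Data.Nat.Properties as ℕ
open import Data.Nat.DivMod
  using (m≡m%n+[m/n]*n; m%n<n; m*n/n≡m; m/n*n≤m; /-monoˡ-≤; m<n*o⇒m/o<n; 0/n≡0; /-congʳ; m/n/o≡m/[n*o]; +-distrib-/-∣ˡ; m<n⇒m/n≡0)
open import Data.Nat.Divisibility
  using (_∣_; _∣?_; ∣-refl; ∣-trans; ∣⇒≤; >⇒∤; divides; divides-refl; ∣m⇒∣m*n; *-cancelʳ-∣; *-monoˡ-∣)
open import Data.Nat.GCD using (gcd; gcd-GCD; gcd[m,n]∣m; gcd[m,n]∣n; gcd[m,n]≢0; module Bézout)
open import Data.Nat.Primality using (Prime; prime⇒irreducible)
open import Data.Nat.Coprimality using (Coprime; coprime-divisor)
open import Data.Nat.Tactic.RingSolver using () renaming (solve-∀ to ℕ-solve-∀)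
open import Data.Integer using (ℤ; +_; -[1+_]) renaming (_+_ to _+ℤ_; _*_ to _*ℤ_; -_ to -ℤ_)
import Data.Integer.Properties as ℤ
open import Data.List using (List; []; _∷_; map; drop; _++_; applyDownFrom)
open import Data.List.Relation.Unary.All using (All; []; _∷_)
import Data.List.Relation.Unary.All as All
import Data.List.Relation.Unary.All.Properties as All
open import Data.List.Extrema.Nat using (max; xs≤max)
open import Data.Maybe using (Maybe; just; nothing)
open import Data.Product using (∃; ∃₂; _,_; proj₁; proj₂)
open import Data.Sum using (inj₁; inj₂; [_,_]′)
open import Data.Empty using (⊥-elim)
open import Function using (_∘′_)
open import Relation.Nullary using (Dec; yes; no; ¬_)
open import Relation.Binary.PropositionalEquality
  using (_≡_; _≢_; refl; sym; trans; cong; cong₂; subst; module ≡-Reasoning)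
open import Relation.Binary.Structures using (IsEquivalence)
open import Relation.Binary.Bundles using (Setoid)
import Relation.Binary.Reasoning.Setoid as SetoidReasoning
open import Algebra.Bundles using (CommutativeSemigroup; CommutativeRing)
import Algebra.Properties.CommutativeSemigroup as CommutativeSemigroupProperties
open import Tactic.RingSolver.Core.AlmostCommutativeRing using (AlmostCommutativeRing; fromCommutativeRing)
open import Tactic.RingSolver using (solve-∀)

-- The ring ℤ[q]

-- A record version of _≈P_, so that both sides can be inferred from a proof.
infix 4 _≋_
record _≋_ (p r : Poly) : Set where
  constructor coeffwise
  field coeff-≡ : ∀ d → coeff p d ≡ coeff r d
open _≋_ public

≋-refl : ∀ {p} → p ≋ p
≋-refl = coeffwise λ _ → refl

≋-sym : ∀ {p r} → p ≋ r → r ≋ p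
≋-sym e = coeffwise λ d → sym (coeff-≡ e d)

≋-trans : ∀ {p r s} → p ≋ r → r ≋ s → p ≋ s
≋-trans e f = coeffwise λ d → trans (coeff-≡ e d) (coeff-≡ f d)

≡⇒≋ : ∀ {p r} → p ≡ r → p ≋ r
≡⇒≋ refl = ≋-refl

≋-isEquivalence : IsEquivalence _≋_
≋-isEquivalence = record { refl = ≋-refl ; sym = ≋-sym ; trans = ≋-trans }

≋-setoid : Setoid _ _
≋-setoid = record { isEquivalence = ≋-isEquivalence }

module ≋-Reasoning = SetoidReasoning ≋-setoid

-P_ : Poly → Poly
-P_ = map -ℤ_

coeff-+P : ∀ p r d → coeff (p +P r) d ≡ coeff p d +ℤ coeff r d
coeff-+P []      r       d       = sym (ℤ.+-identityˡ _)
coeff-+P (a ∷ p) []      d       = sym (ℤ.+-identityʳ _)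
coeff-+P (a ∷ p) (b ∷ r) zero    = refl
coeff-+P (a ∷ p) (b ∷ r) (suc d) = coeff-+P p r d

coeff-scale : ∀ c p d → coeff (scale c p) d ≡ c *ℤ coeff p d
coeff-scale c []      d       = sym (ℤ.*-zeroʳ c)
coeff-scale c (a ∷ p) zero    = refl
coeff-scale c (a ∷ p) (suc d) = coeff-scale c p d

coeff--P : ∀ p d → coeff (-P p) d ≡ -ℤ coeff p d
coeff--P []      d       = refl
coeff--P (a ∷ p) zero    = refl
coeff--P (a ∷ p) (suc d) = coeff--P p d

+P-cong : ∀ {p p' r r'} → p ≋ p' → r ≋ r' → p +P r ≋ p' +P r'
+P-cong {p} {p'} {r} {r'} e f = coeffwise λ d →
  trans (coeff-+P p r d) (trans (cong₂ _+ℤ_ (coeff-≡ e d) (coeff-≡ f d)) (sym (coeff-+P p' r' d)))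

+P-comm : ∀ p r → p +P r ≋ r +P p
+P-comm p r = coeffwise λ d →
  trans (coeff-+P p r d) (trans (ℤ.+-comm (coeff p d) _) (sym (coeff-+P r p d)))

+P-assoc : ∀ p r s → (p +P r) +P s ≋ p +P (r +P s)
+P-assoc p r s = coeffwise λ d → begin
  coeff ((p +P r) +P s) d                ≡⟨ coeff-+P (p +P r) s d ⟩
  coeff (p +P r) d +ℤ coeff s d          ≡⟨ cong (_+ℤ coeff s d) (coeff-+P p r d) ⟩
  coeff p d +ℤ coeff r d +ℤ coeff s d    ≡⟨ ℤ.+-assoc (coeff p d) _ _ ⟩
  coeff p d +ℤ (coeff r d +ℤ coeff s d)  ≡⟨ cong (coeff p d +ℤ_) (coeff-+P r s d) ⟨
  coeff p d +ℤ coeff (r +P s) d          ≡⟨ coeff-+P p (r +P s) d ⟨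
  coeff (p +P (r +P s)) d                ∎
  where open ≡-Reasoning

+P-identityʳ : ∀ p → p +P [] ≋ p
+P-identityʳ p = coeffwise λ d → trans (coeff-+P p [] d) (ℤ.+-identityʳ _)

+P-inverseʳ : ∀ p → p +P -P p ≋ []
+P-inverseʳ p = coeffwise λ d →
  trans (coeff-+P p (-P p) d) (trans (cong (coeff p d +ℤ_) (coeff--P p d)) (ℤ.+-inverseʳ (coeff p d)))

-P-cong : ∀ {p r} → p ≋ r → -P p ≋ -P r
-P-cong {p} {r} e = coeffwise λ d →
  trans (coeff--P p d) (trans (cong -ℤ_ (coeff-≡ e d)) (sym (coeff--P r d)))

+P-commutativeSemigroup : CommutativeSemigroup _ _
+P-commutativeSemigroup = record
  { Carrier = Poly ; _≈_ = _≋_ ; _∙_ = _+P_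
  ; isCommutativeSemigroup = record
    { isSemigroup = record
      { isMagma = record { isEquivalence = ≋-isEquivalence ; ∙-cong = +P-cong }
      ; assoc = +P-assoc }
    ; comm = +P-comm } }

open CommutativeSemigroupProperties +P-commutativeSemigroup
  using () renaming (interchange to +P-interchange; x∙yz≈y∙xz to +P-left-comm)

scale-cong : ∀ c {p r} → p ≋ r → scale c p ≋ scale c r
scale-cong c {p} {r} e = coeffwise λ d →
  trans (coeff-scale c p d) (trans (cong (c *ℤ_) (coeff-≡ e d)) (sym (coeff-scale c r d)))

scale-distrib-+P : ∀ c p r → scale c (p +P r) ≋ scale c p +P scale c r
scale-distrib-+P c p r = coeffwise λ d → begin
  coeff (scale c (p +P r)) d                   ≡⟨ coeff-scale c (p +P r) d ⟩
  c *ℤ coeff (p +P r) d                        ≡⟨ cong (c *ℤ_) (coeff-+P p r d) ⟩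
  c *ℤ (coeff p d +ℤ coeff r d)                ≡⟨ ℤ.*-distribˡ-+ c (coeff p d) _ ⟩
  c *ℤ coeff p d +ℤ c *ℤ coeff r d             ≡⟨ cong₂ _+ℤ_ (coeff-scale c p d) (coeff-scale c r d) ⟨
  coeff (scale c p) d +ℤ coeff (scale c r) d   ≡⟨ coeff-+P (scale c p) (scale c r) d ⟨
  coeff (scale c p +P scale c r) d             ∎
  where open ≡-Reasoning

scale-assoc : ∀ a b p → scale (a *ℤ b) p ≋ scale a (scale b p)
scale-assoc a b p = coeffwise λ d → begin
  coeff (scale (a *ℤ b) p) d    ≡⟨ coeff-scale (a *ℤ b) p d ⟩
  a *ℤ b *ℤ coeff p d           ≡⟨ ℤ.*-assoc a b _ ⟩
  a *ℤ (b *ℤ coeff p d)         ≡⟨ cong (a *ℤ_) (coeff-scale b p d) ⟨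
  a *ℤ coeff (scale b p) d      ≡⟨ coeff-scale a (scale b p) d ⟨
  coeff (scale a (scale b p)) d ∎
  where open ≡-Reasoning

scale--P : ∀ c p → scale c (-P p) ≋ -P scale c p
scale--P c p = coeffwise λ d → begin
  coeff (scale c (-P p)) d   ≡⟨ coeff-scale c (-P p) d ⟩
  c *ℤ coeff (-P p) d        ≡⟨ cong (c *ℤ_) (coeff--P p d) ⟩
  c *ℤ -ℤ coeff p d          ≡⟨ ℤ.neg-distribʳ-* c (coeff p d) ⟨
  -ℤ (c *ℤ coeff p d)        ≡⟨ cong -ℤ_ (coeff-scale c p d) ⟨
  -ℤ coeff (scale c p) d     ≡⟨ coeff--P (scale c p) d ⟨
  coeff (-P scale c p) d     ∎
  where open ≡-Reasoning

scale-zero : ∀ p → scale (+ 0) p ≋ []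
scale-zero p = coeffwise (coeff-scale (+ 0) p)

scale-identity : ∀ p → scale (+ 1) p ≋ p
scale-identity p = coeffwise λ d → trans (coeff-scale (+ 1) p d) (ℤ.*-identityˡ _)

∷-cong : ∀ {a b p r} → a ≡ b → p ≋ r → a ∷ p ≋ b ∷ r
∷-cong a≡b e = coeffwise λ { zero → a≡b ; (suc d) → coeff-≡ e d }

∷-injectiveʳ : ∀ {a b p r} → a ∷ p ≋ b ∷ r → p ≋ r
∷-injectiveʳ e = coeffwise λ d → coeff-≡ e (suc d)

0∷[]≋[] : + 0 ∷ [] ≋ []
0∷[]≋[] = coeffwise λ { zero → refl ; (suc d) → refl }

coeff₀∷drop : ∀ p → p ≋ coeff p 0 ∷ drop 1 p
coeff₀∷drop []      = ≋-sym 0∷[]≋[]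
coeff₀∷drop (a ∷ p) = ≋-refl

*P-zeroˡ : ∀ {p} r → p ≋ [] → p *P r ≋ []
*P-zeroˡ {[]}    r e = ≋-refl
*P-zeroˡ {a ∷ p} r e = ≋-trans
  (+P-cong (≋-trans (≡⇒≋ (cong (λ x → scale x r) (coeff-≡ e 0))) (scale-zero r))
           (∷-cong refl (*P-zeroˡ {p} r (coeffwise λ d → coeff-≡ e (suc d)))))
  0∷[]≋[]

*P-zeroʳ : ∀ p → p *P [] ≋ []
*P-zeroʳ []      = ≋-refl
*P-zeroʳ (a ∷ p) = ≋-trans (∷-cong refl (*P-zeroʳ p)) 0∷[]≋[]

*P-congˡ : ∀ {p p'} r → p ≋ p' → p *P r ≋ p' *P r
*P-congˡ {[]}    {p'}     r e = ≋-sym (*P-zeroˡ r (≋-sym e))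
*P-congˡ {a ∷ p} {[]}     r e = *P-zeroˡ r e
*P-congˡ {a ∷ p} {b ∷ p'} r e =
  +P-cong (≡⇒≋ (cong (λ x → scale x r) (coeff-≡ e 0))) (∷-cong refl (*P-congˡ r (∷-injectiveʳ e)))

*P-congʳ : ∀ p {r r'} → r ≋ r' → p *P r ≋ p *P r'
*P-congʳ []      e = ≋-refl
*P-congʳ (a ∷ p) e = +P-cong (scale-cong a e) (∷-cong refl (*P-congʳ p e))

*P-cong : ∀ {p p' r r'} → p ≋ p' → r ≋ r' → p *P r ≋ p' *P r'
*P-cong {p} {p'} {r} e f = ≋-trans (*P-congˡ r e) (*P-congʳ p' f)

*P-∷ʳ : ∀ p b r → p *P (b ∷ r) ≋ scale b p +P (+ 0 ∷ p *P r)
*P-∷ʳ []      b r = ≋-sym 0∷[]≋[]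
*P-∷ʳ (a ∷ p) b r = ∷-cong (cong (_+ℤ + 0) (ℤ.*-comm a b))
  (≋-trans (+P-cong (≋-refl {scale a r}) (*P-∷ʳ p b r)) (+P-left-comm (scale a r) (scale b p) _))

*P-comm : ∀ p r → p *P r ≋ r *P p
*P-comm []      r = ≋-sym (*P-zeroʳ r)
*P-comm (a ∷ p) r =
  ≋-trans (+P-cong (≋-refl {scale a r}) (∷-cong refl (*P-comm p r))) (≋-sym (*P-∷ʳ r a p))

*P-distribˡ : ∀ p r s → p *P (r +P s) ≋ p *P r +P p *P s
*P-distribˡ []      r s = ≋-refl
*P-distribˡ (a ∷ p) r s = ≋-trans
  (+P-cong (scale-distrib-+P a r s) (∷-cong refl (*P-distribˡ p r s)))
  (+P-interchange (scale a r) (scale a s) (+ 0 ∷ p *P r) (+ 0 ∷ p *P s))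

*P-distribʳ : ∀ p r s → (r +P s) *P p ≋ r *P p +P s *P p
*P-distribʳ p r s = ≋-trans (*P-comm (r +P s) p)
  (≋-trans (*P-distribˡ p r s) (+P-cong (*P-comm p r) (*P-comm p s)))

scale-*P : ∀ a r s → scale a r *P s ≋ scale a (r *P s)
scale-*P a []      s = ≋-refl
scale-*P a (b ∷ r) s = ≋-trans
  (+P-cong (scale-assoc a b s) (∷-cong (sym (ℤ.*-zeroʳ a)) (scale-*P a r s)))
  (≋-sym (scale-distrib-+P a (scale b s) (+ 0 ∷ r *P s)))

*P-assoc : ∀ p r s → (p *P r) *P s ≋ p *P (r *P s)
*P-assoc []      r s = ≋-refl
*P-assoc (a ∷ p) r s = ≋-trans (*P-distribʳ s (scale a r) (+ 0 ∷ p *P r))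
  (+P-cong (scale-*P a r s)
           (≋-trans (+P-cong (scale-zero s) ≋-refl) (∷-cong refl (*P-assoc p r s))))

*P-identityˡ : ∀ p → oneP *P p ≋ p
*P-identityˡ p = ≋-trans (+P-cong (scale-identity p) 0∷[]≋[]) (+P-identityʳ p)

*P-identityʳ : ∀ p → p *P oneP ≋ p
*P-identityʳ p = ≋-trans (*P-comm p oneP) (*P-identityˡ p)

scale≋constP*P : ∀ c p → scale c p ≋ constP c *P p
scale≋constP*P c p = ≋-sym (≋-trans (+P-cong (≋-refl {scale c p}) 0∷[]≋[]) (+P-identityʳ (scale c p)))

constP-*P : ∀ a b → constP a *P constP b ≋ constP (a *ℤ b)
constP-*P a b = ∷-cong (ℤ.+-identityʳ (a *ℤ b)) ≋-refl

Poly-commutativeRing : CommutativeRing _ _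
Poly-commutativeRing = record
  { Carrier = Poly ; _≈_ = _≋_ ; _+_ = _+P_ ; _*_ = _*P_ ; -_ = -P_ ; 0# = [] ; 1# = oneP
  ; isCommutativeRing = record
    { isRing = record
      { +-isAbelianGroup = record
        { isGroup = record
          { isMonoid = record
            { isSemigroup = record
              { isMagma = record { isEquivalence = ≋-isEquivalence ; ∙-cong = +P-cong }
              ; assoc = +P-assoc }
            ; identity = (λ _ → ≋-refl) , +P-identityʳ }
          ; inverse = (λ p → ≋-trans (+P-comm (-P p) p) (+P-inverseʳ p)) , +P-inverseʳ
          ; ⁻¹-cong = -P-cong }
        ; comm = +P-comm }
      ; *-cong = *P-cong
      ; *-assoc = *P-assoc
      ; *-identity = *P-identityˡ , *P-identityʳ
      ; distrib = *P-distribˡ , *P-distribʳ }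
    ; *-comm = *P-comm } }

-- The solver only needs a sound, possibly incomplete, zero test.
[]≋? : ∀ p → Maybe ([] ≋ p)
[]≋? []               = just ≋-refl
[]≋? (+ zero ∷ p)     with []≋? p
... | just []≋p = just (≋-trans (≋-sym 0∷[]≋[]) (∷-cong refl []≋p))
... | nothing   = nothing
[]≋? (+ suc _ ∷ _)    = nothing
[]≋? (-[1+ _ ] ∷ _)   = nothing

Poly-almostCommutativeRing : AlmostCommutativeRing _ _
Poly-almostCommutativeRing = fromCommutativeRing Poly-commutativeRing []≋?

-- Divisibility

infix 4 _∣P_
_∣P_ : Poly → Poly → Set
A ∣P B = ∃ λ X → X *P A ≋ B

∣P-refl : ∀ A → A ∣P A
∣P-refl A = oneP , *P-identityˡ A

oneP-∣P : ∀ B → oneP ∣P B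
oneP-∣P B = B , *P-identityʳ B

∣P-trans : ∀ {A B C} → A ∣P B → B ∣P C → A ∣P C
∣P-trans {A} (X , XA≋B) (Y , YB≋C) = Y *P X , ≋-trans (*P-assoc Y X A) (≋-trans (*P-congʳ Y XA≋B) YB≋C)

∣P-respʳ : ∀ {A B B'} → B ≋ B' → A ∣P B → A ∣P B'
∣P-respʳ B≋B' (X , XA≋B) = X , ≋-trans XA≋B B≋B'

∣P-respˡ : ∀ {A A' B} → A ≋ A' → A ∣P B → A' ∣P B
∣P-respˡ {A} A≋A' (X , XA≋B) = X , ≋-trans (*P-congʳ X (≋-sym A≋A')) XA≋B

∣P-*P : ∀ {A B C D} → A ∣P B → C ∣P D → A *P C ∣P B *P D
∣P-*P {A} {B} {C} {D} (X , XA≋B) (Y , YC≋D) =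
  X *P Y , ≋-trans (interchange X Y A C) (*P-cong XA≋B YC≋D)
  where
  interchange : ∀ x y a c → (x *P y) *P (a *P c) ≋ (x *P a) *P (y *P c)
  interchange = solve-∀ Poly-almostCommutativeRing

coeff₀-*P : ∀ p r → coeff (p *P r) 0 ≡ coeff p 0 *ℤ coeff r 0
coeff₀-*P []      r = refl
coeff₀-*P (a ∷ p) r = trans (coeff-+P (scale a r) (+ 0 ∷ p *P r) 0)
  (trans (ℤ.+-identityʳ _) (coeff-scale a r 0))

record ConstantTermOne (p : Poly) : Set where
  constructor constantTermOne
  field coeff₀≡1 : coeff p 0 ≡ + 1
open ConstantTermOne public

constantTermOne-oneP : ConstantTermOne oneP
constantTermOne-oneP = constantTermOne refl

constantTermOne-resp : ∀ {A B} → A ≋ B → ConstantTermOne A → ConstantTermOne B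
constantTermOne-resp A≋B (constantTermOne A₀≡1) = constantTermOne (trans (sym (coeff-≡ A≋B 0)) A₀≡1)

constantTermOne-*P : ∀ {A B} → ConstantTermOne A → ConstantTermOne B → ConstantTermOne (A *P B)
constantTermOne-*P {A} {B} (constantTermOne A₀≡1) (constantTermOne B₀≡1) =
  constantTermOne (trans (coeff₀-*P A B) (cong₂ _*ℤ_ A₀≡1 B₀≡1))

constantTermOne-quotient : ∀ {X A B} → X *P A ≋ B → ConstantTermOne A → ConstantTermOne B → ConstantTermOne X
constantTermOne-quotient {X} {A} XA≋B (constantTermOne A₀≡1) (constantTermOne B₀≡1) = constantTermOne (begin
  coeff X 0                  ≡⟨ ℤ.*-identityʳ (coeff X 0) ⟨
  coeff X 0 *ℤ + 1           ≡⟨ cong (coeff X 0 *ℤ_) A₀≡1 ⟨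
  coeff X 0 *ℤ coeff A 0     ≡⟨ coeff₀-*P X A ⟨
  coeff (X *P A) 0           ≡⟨ trans (coeff-≡ XA≋B 0) B₀≡1 ⟩
  + 1                        ∎)
  where open ≡-Reasoning

X*A≋[]⇒X≋[] : ∀ {A} → ConstantTermOne A → ∀ Z → Z *P A ≋ [] → Z ≋ []
X*A≋[]⇒X≋[] {[]}     (constantTermOne ())
X*A≋[]⇒X≋[] {a ∷ A} (constantTermOne refl) []      ZA≋[] = ≋-refl
X*A≋[]⇒X≋[] {a ∷ A} (constantTermOne refl) (z ∷ Z) ZA≋[] =
  ≋-trans (∷-cong z≡0 (X*A≋[]⇒X≋[] (constantTermOne refl) Z ZA'≋[])) 0∷[]≋[]
  where
  z≡0 : z ≡ + 0
  z≡0 = trans (sym (trans (ℤ.+-identityʳ _) (ℤ.*-identityʳ z))) (coeff-≡ ZA≋[] 0)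
  ZA'≋[] : Z *P (+ 1 ∷ A) ≋ []
  ZA'≋[] = ≋-trans (+P-cong (≋-sym (≋-trans (≡⇒≋ (cong (λ c → scale c A) z≡0)) (scale-zero A))) ≋-refl)
                   (coeffwise λ d → coeff-≡ ZA≋[] (suc d))

*P-cancelʳ : ∀ {A} → ConstantTermOne A → ∀ X Y → X *P A ≋ Y *P A → X ≋ Y
*P-cancelʳ {A} A₁ X Y XA≋YA = ≋-trans (split X Y) (+P-cong (X*A≋[]⇒X≋[] A₁ (X +P -P Y) difference) ≋-refl)
  where
  split : ∀ x y → x ≋ (x +P -P y) +P y
  split = solve-∀ Poly-almostCommutativeRing
  distrib : ∀ x y a → (x +P -P y) *P a ≋ x *P a +P -P (y *P a)
  distrib = solve-∀ Poly-almostCommutativeRing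
  difference : (X +P -P Y) *P A ≋ []
  difference = ≋-trans (distrib X Y A) (≋-trans (+P-cong XA≋YA ≋-refl) (+P-inverseʳ (Y *P A)))

-- Gauss's lemma for divisors with constant term one; the quotient is found coefficient by coefficient from the bottom.
∣P-scale-cancel : ∀ {D} c → c ≢ + 0 → ConstantTermOne D → ∀ C X → X *P D ≋ scale c C → D ∣P C
∣P-scale-cancel c c≢0 D₁ C [] []≋cC = [] , coeffwise λ d →
  [ (λ c≡0 → ⊥-elim (c≢0 c≡0)) , sym ]′ (ℤ.i*j≡0⇒i≡0∨j≡0 c (sym (trans (coeff-≡ []≋cC d) (coeff-scale c C d))))
∣P-scale-cancel {D} c c≢0 D₁ C (x ∷ X) xX·D≋cC = C₀ ∷ Y , (begin
  scale C₀ D +P (+ 0 ∷ Y *P D)   ≈⟨ +P-cong (≋-refl {scale C₀ D}) (∷-cong refl YD≋W) ⟩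
  scale C₀ D +P (+ 0 ∷ W)        ≈⟨ +P-cong (≋-refl {scale C₀ D}) R≋0∷W ⟨
  scale C₀ D +P R                ≈⟨ cancel (scale C₀ D) C ⟩
  C                              ∎)
  where
  open ≋-Reasoning
  cancel : ∀ s p → s +P (p +P -P s) ≋ p
  cancel = solve-∀ Poly-almostCommutativeRing
  C₀ : ℤ
  C₀ = coeff C 0
  R : Poly
  R = C +P -P scale C₀ D
  W : Poly
  W = drop 1 R
  D₀≡1 : coeff D 0 ≡ + 1
  D₀≡1 = coeff₀≡1 D₁
  R₀≡0 : coeff R 0 ≡ + 0
  R₀≡0 = trans (coeff-+P C (-P scale C₀ D) 0) (trans (cong (C₀ +ℤ_) (trans (coeff--P (scale C₀ D) 0)
    (cong -ℤ_ (trans (coeff-scale C₀ D 0) (trans (cong (C₀ *ℤ_) D₀≡1) (ℤ.*-identityʳ C₀)))))) (ℤ.+-inverseʳ C₀))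
  R≋0∷W : R ≋ + 0 ∷ W
  R≋0∷W = ≋-trans (coeff₀∷drop R) (∷-cong R₀≡0 ≋-refl)
  x≡cC₀ : x ≡ c *ℤ C₀
  x≡cC₀ = trans (sym (ℤ.*-identityʳ x)) (trans (cong (x *ℤ_) (sym D₀≡1))
    (trans (sym (coeff₀-*P (x ∷ X) D)) (trans (coeff-≡ xX·D≋cC 0) (coeff-scale c C 0))))
  unshift : ∀ s t → t ≋ (s +P t) +P -P s
  unshift = solve-∀ Poly-almostCommutativeRing
  0∷XD≋cR : + 0 ∷ X *P D ≋ scale c R
  0∷XD≋cR = begin
    + 0 ∷ X *P D                                   ≈⟨ unshift (scale x D) (+ 0 ∷ X *P D) ⟩
    (scale x D +P (+ 0 ∷ X *P D)) +P -P scale x D  ≈⟨ +P-cong xX·D≋cC (-P-cong (≡⇒≋ (cong (λ a → scale a D) x≡cC₀))) ⟩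
    scale c C +P -P scale (c *ℤ C₀) D              ≈⟨ +P-cong (≋-refl {scale c C}) (-P-cong (scale-assoc c C₀ D)) ⟩
    scale c C +P -P scale c (scale C₀ D)           ≈⟨ +P-cong (≋-refl {scale c C}) (scale--P c (scale C₀ D)) ⟨
    scale c C +P scale c (-P scale C₀ D)           ≈⟨ scale-distrib-+P c C (-P scale C₀ D) ⟨
    scale c R                                      ∎
  XD≋cW : X *P D ≋ scale c W
  XD≋cW = ∷-injectiveʳ (≋-trans 0∷XD≋cR (≋-trans (scale-cong c R≋0∷W) (∷-cong (ℤ.*-zeroʳ c) ≋-refl)))
  Y : Poly
  Y = proj₁ (∣P-scale-cancel c c≢0 D₁ W X XD≋cW)
  YD≋W : Y *P D ≋ W
  YD≋W = proj₂ (∣P-scale-cancel c c≢0 D₁ W X XD≋cW)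

∣P-cancelʳ : ∀ {A B C} → ConstantTermOne C → A *P C ∣P B *P C → A ∣P B
∣P-cancelʳ {A} {B} {C} C₁ (X , X[AC]≋BC) = X , *P-cancelʳ C₁ (X *P A) B (≋-trans (*P-assoc X A C) X[AC]≋BC)

-- Coprimality in ℚ[q], witnessed in ℤ[q] by a Bézout identity with a non-zero integer on the right.
record CoprimeOverℚ (A B : Poly) : Set where
  constructor bezout
  field
    U V      : Poly
    c        : ℤ
    c≢0      : c ≢ + 0
    identity : U *P A +P V *P B ≋ constP c

coprimeOverℚ-sym : ∀ {A B} → CoprimeOverℚ A B → CoprimeOverℚ B A
coprimeOverℚ-sym {A} {B} (bezout U V c c≢0 UA+VB≋c) =
  bezout V U c c≢0 (≋-trans (+P-comm (V *P B) (U *P A)) UA+VB≋c)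

coprimeOverℚ-oneʳ : ∀ A → CoprimeOverℚ A oneP
coprimeOverℚ-oneʳ A = bezout [] oneP (+ 1) (λ ()) (*P-identityˡ oneP)

coprimeOverℚ-*P : ∀ {A B₁ B₂} → CoprimeOverℚ A B₁ → CoprimeOverℚ A B₂ → CoprimeOverℚ A (B₁ *P B₂)
coprimeOverℚ-*P {A} {B₁} {B₂} (bezout U₁ V₁ c₁ c₁≢0 e₁) (bezout U₂ V₂ c₂ c₂≢0 e₂) =
  bezout (U₁ *P U₂ *P A +P U₁ *P V₂ *P B₂ +P V₁ *P U₂ *P B₁) (V₁ *P V₂) (c₁ *ℤ c₂) c₁c₂≢0
    (≋-trans (expand U₁ U₂ V₁ V₂ A B₁ B₂) (≋-trans (*P-cong e₁ e₂) (constP-*P c₁ c₂)))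
  where
  c₁c₂≢0 : c₁ *ℤ c₂ ≢ + 0
  c₁c₂≢0 c₁c₂≡0 = [ c₁≢0 , c₂≢0 ]′ (ℤ.i*j≡0⇒i≡0∨j≡0 c₁ c₁c₂≡0)
  expand : ∀ u₁ u₂ v₁ v₂ a b₁ b₂ →
    (u₁ *P u₂ *P a +P u₁ *P v₂ *P b₂ +P v₁ *P u₂ *P b₁) *P a +P (v₁ *P v₂) *P (b₁ *P b₂)
      ≋ (u₁ *P a +P v₁ *P b₁) *P (u₂ *P a +P v₂ *P b₂)
  expand = solve-∀ Poly-almostCommutativeRing

coprimeOverℚ-combination : ∀ {A B W} X Y → B ≋ X *P A +P Y *P W → CoprimeOverℚ A B → CoprimeOverℚ A W
coprimeOverℚ-combination {A} {B} {W} X Y B≋XA+YW (bezout U V c c≢0 UA+VB≋c) =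
  bezout (U +P V *P X) (V *P Y) c c≢0 (≋-trans (regroup U V X Y A W)
    (≋-trans (+P-cong (≋-refl {U *P A}) (*P-congʳ V (≋-sym B≋XA+YW))) UA+VB≋c))
  where
  regroup : ∀ u v x y a w → (u +P v *P x) *P a +P (v *P y) *P w ≋ u *P a +P v *P (x *P a +P y *P w)
  regroup = solve-∀ Poly-almostCommutativeRing

coprimeOverℚ-∣ʳ : ∀ {A B W} → W ∣P B → CoprimeOverℚ A B → CoprimeOverℚ A W
coprimeOverℚ-∣ʳ {A} {B} {W} (Y , YW≋B) =
  coprimeOverℚ-combination [] Y (≋-sym YW≋B)

coprimeOverℚ-∣ˡ : ∀ {A A' B} → A' ∣P A → CoprimeOverℚ A B → CoprimeOverℚ A' B
coprimeOverℚ-∣ˡ A'∣A = coprimeOverℚ-sym ∘′ coprimeOverℚ-∣ʳ A'∣A ∘′ coprimeOverℚ-sym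

coprimeOverℚ⇒*P-∣P : ∀ {A B C} → CoprimeOverℚ A B → ConstantTermOne A → ConstantTermOne B →
                      A ∣P C → B ∣P C → A *P B ∣P C
coprimeOverℚ⇒*P-∣P {A} {B} {C} (bezout U V c c≢0 UA+VB≋c) A₁ B₁ (α , αA≋C) (β , βB≋C) =
  ∣P-scale-cancel c c≢0 (constantTermOne-*P A₁ B₁) C (β *P U +P α *P V) (begin
    (β *P U +P α *P V) *P (A *P B)            ≈⟨ regroup α β U V A B ⟩
    (U *P A) *P (β *P B) +P (V *P B) *P (α *P A) ≈⟨ +P-cong (*P-congʳ (U *P A) βB≋C) (*P-congʳ (V *P B) αA≋C) ⟩
    (U *P A) *P C +P (V *P B) *P C            ≈⟨ *P-distribʳ C (U *P A) (V *P B) ⟨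
    (U *P A +P V *P B) *P C                   ≈⟨ *P-congˡ C UA+VB≋c ⟩
    constP c *P C                             ≈⟨ scale≋constP*P c C ⟨
    scale c C                                 ∎)
  where
  open ≋-Reasoning
  regroup : ∀ α β u v a b → (β *P u +P α *P v) *P (a *P b) ≋ (u *P a) *P (β *P b) +P (v *P b) *P (α *P a)
  regroup = solve-∀ Poly-almostCommutativeRing

-- q-integers

monoP-+ : ∀ a b → monoP (a + b) ≋ monoP a *P monoP b
monoP-+ zero    b = ≋-sym (*P-identityˡ (monoP b))
monoP-+ (suc a) b = ≋-trans (∷-cong refl (monoP-+ a b)) (≋-sym (+P-cong (scale-zero (monoP b)) ≋-refl))

qintPow-+ : ∀ g a b → qintPow g (a + b) ≋ qintPow g a +P monoP (g * a) *P qintPow g b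
qintPow-+ g a zero = begin
  qintPow g (a + 0)                        ≡⟨ cong (qintPow g) (ℕ.+-identityʳ a) ⟩
  qintPow g a                              ≈⟨ +P-identityʳ (qintPow g a) ⟨
  qintPow g a +P []                        ≈⟨ +P-cong (≋-refl {qintPow g a}) (*P-zeroʳ (monoP (g * a))) ⟨
  qintPow g a +P monoP (g * a) *P []       ∎
  where open ≋-Reasoning
qintPow-+ g a (suc b) = begin
  qintPow g (a + suc b)                          ≡⟨ cong (qintPow g) (ℕ.+-suc a b) ⟩
  qintPow g (a + b) +P monoP (g * (a + b))       ≈⟨ +P-cong (qintPow-+ g a b) (≋-trans
                                                      (≡⇒≋ (cong monoP (ℕ.*-distribˡ-+ g a b))) (monoP-+ (g * a) (g * b))) ⟩
  (Qa +P Ma *P Qb) +P Ma *P monoP (g * b)        ≈⟨ factor Qa Ma Qb (monoP (g * b)) ⟩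
  Qa +P Ma *P (Qb +P monoP (g * b))              ∎
  where
  open ≋-Reasoning
  Qa : Poly
  Qa = qintPow g a
  Qb : Poly
  Qb = qintPow g b
  Ma : Poly
  Ma = monoP (g * a)
  factor : ∀ qa ma qb mb → (qa +P ma *P qb) +P ma *P mb ≋ qa +P ma *P (qb +P mb)
  factor = solve-∀ Poly-almostCommutativeRing

qintPow-suc : ∀ g b → qintPow g (suc b) ≋ oneP +P monoP g *P qintPow g b
qintPow-suc g b = ≋-trans (qintPow-+ g 1 b)
  (+P-cong (≡⇒≋ (cong monoP (ℕ.*-zeroʳ g))) (≡⇒≋ (cong (λ e → monoP e *P qintPow g b) (ℕ.*-identityʳ g))))

qintPow-* : ∀ g a b → qintPow g (a * b) ≋ qintPow g a *P qintPow (g * a) b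
qintPow-* g a zero = begin
  qintPow g (a * 0)          ≡⟨ cong (qintPow g) (ℕ.*-zeroʳ a) ⟩
  []                         ≈⟨ *P-zeroʳ (qintPow g a) ⟨
  qintPow g a *P []          ∎
  where open ≋-Reasoning
qintPow-* g a (suc b) = begin
  qintPow g (a * suc b)                  ≡⟨ cong (qintPow g) (ℕ.*-suc a b) ⟩
  qintPow g (a + a * b)                  ≈⟨ qintPow-+ g a (a * b) ⟩
  Qa +P M *P qintPow g (a * b)           ≈⟨ +P-cong (≋-refl {Qa}) (*P-congʳ M (qintPow-* g a b)) ⟩
  Qa +P M *P (Qa *P R)                   ≈⟨ factor Qa M R ⟩
  Qa *P (oneP +P M *P R)                 ≈⟨ *P-congʳ Qa (qintPow-suc (g * a) b) ⟨
  Qa *P qintPow (g * a) (suc b)          ∎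
  where
  open ≋-Reasoning
  Qa : Poly
  Qa = qintPow g a
  M : Poly
  M = monoP (g * a)
  R : Poly
  R = qintPow (g * a) b
  factor : ∀ qa m r → qa +P m *P (qa *P r) ≋ qa *P (oneP +P m *P r)
  factor = solve-∀ Poly-almostCommutativeRing

qint-* : ∀ a b → qint (a * b) ≋ qint a *P qintPow a b
qint-* a b = ≋-trans (qintPow-* 1 a b) (≡⇒≋ (cong (λ g → qint a *P qintPow g b) (ℕ.*-identityˡ a)))

qint-∣ : ∀ {a b} → a ∣ b → qint a ∣P qint b
qint-∣ {a} (divides h refl) = qintPow a h ,
  ≋-trans (*P-comm (qintPow a h) (qint a)) (≋-trans (≋-sym (qint-* a h)) (≡⇒≋ (cong qint (ℕ.*-comm a h))))

constantTermOne-qintPow : ∀ g j → ConstantTermOne (qintPow (suc g) (suc j))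
constantTermOne-qintPow g j = constantTermOne-resp (≋-sym (qintPow-suc (suc g) j))
  (constantTermOne (trans (coeff-+P oneP (monoP (suc g) *P qintPow (suc g) j) 0)
    (cong (+ 1 +ℤ_) (coeff₀-*P (monoP (suc g)) (qintPow (suc g) j)))))

constantTermOne-qint : ∀ j → ConstantTermOne (qint (suc j))
constantTermOne-qint = constantTermOne-qintPow 0

monoP≋1+[q-1]qint : ∀ n → monoP n ≋ oneP +P (monoP 1 +P -P oneP) *P qint n
monoP≋1+[q-1]qint zero = ≋-sym (≋-trans (+P-cong (≋-refl {oneP}) (*P-zeroʳ (monoP 1 +P -P oneP))) (+P-identityʳ oneP))
monoP≋1+[q-1]qint (suc n) = begin
  monoP (suc n)                                   ≈⟨ monoP-+ 1 n ⟩
  monoP 1 *P monoP n                              ≈⟨ split (monoP 1) (monoP n) ⟩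
  monoP n +P (monoP 1 +P -P oneP) *P monoP n      ≈⟨ +P-cong (monoP≋1+[q-1]qint n) ≋-refl ⟩
  (oneP +P (monoP 1 +P -P oneP) *P qint n) +P (monoP 1 +P -P oneP) *P monoP n
                                                  ≈⟨ factor (monoP 1) (qint n) (monoP n) ⟩
  oneP +P (monoP 1 +P -P oneP) *P (qint n +P monoP n)
                                                  ≡⟨ cong (λ e → oneP +P (monoP 1 +P -P oneP) *P (qint n +P monoP e)) (ℕ.*-identityˡ n) ⟨
  oneP +P (monoP 1 +P -P oneP) *P qint (suc n)    ∎
  where
  open ≋-Reasoning
  split : ∀ x m → x *P m ≋ m +P (x +P -P oneP) *P m
  split = solve-∀ Poly-almostCommutativeRing
  factor : ∀ x Q m → (oneP +P (x +P -P oneP) *P Q) +P (x +P -P oneP) *P m ≋ oneP +P (x +P -P oneP) *P (Q +P m)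
  factor = solve-∀ Poly-almostCommutativeRing

-- Since q^g ≡ 1 modulo [g], also [x]_{q^g} ≡ x modulo [g].
qintPow≡const-mod-qint : ∀ g x → ∃ λ Z → qintPow g x ≋ constP (+ x) +P qint g *P Z
qintPow≡const-mod-qint g zero = [] , ≋-sym (≋-trans (+P-cong 0∷[]≋[] (*P-zeroʳ (qint g))) ≋-refl)
qintPow≡const-mod-qint g (suc x) = Z +P (monoP 1 +P -P oneP) *P qintPow g x , (begin
  qintPow g x +P monoP (g * x)                                  ≈⟨ +P-cong Q≋x+GZ (monoP≋1+[q-1]qint (g * x)) ⟩
  (constP (+ x) +P G *P Z) +P (oneP +P (monoP 1 +P -P oneP) *P qint (g * x))
                                                                ≈⟨ +P-cong (≋-refl {constP (+ x) +P G *P Z})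
                                                                     (+P-cong (≋-refl {oneP}) (*P-congʳ (monoP 1 +P -P oneP) (qint-* g x))) ⟩
  (constP (+ x) +P G *P Z) +P (oneP +P (monoP 1 +P -P oneP) *P (G *P qintPow g x))
                                                                ≈⟨ regroup (constP (+ x)) G Z (monoP 1) (qintPow g x) ⟩
  (constP (+ x) +P oneP) +P G *P (Z +P (monoP 1 +P -P oneP) *P qintPow g x)
                                                                ≈⟨ +P-cong constP-suc (≋-refl {G *P (Z +P (monoP 1 +P -P oneP) *P qintPow g x)}) ⟩
  constP (+ suc x) +P G *P (Z +P (monoP 1 +P -P oneP) *P qintPow g x) ∎)
  where
  open ≋-Reasoning
  G : Poly
  G = qint g
  Z : Poly
  Z = proj₁ (qintPow≡const-mod-qint g x)
  Q≋x+GZ : qintPow g x ≋ constP (+ x) +P G *P Z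
  Q≋x+GZ = proj₂ (qintPow≡const-mod-qint g x)
  regroup : ∀ c G Z x Q → (c +P G *P Z) +P (oneP +P (x +P -P oneP) *P (G *P Q)) ≋ (c +P oneP) +P G *P (Z +P (x +P -P oneP) *P Q)
  regroup = solve-∀ Poly-almostCommutativeRing
  constP-suc : constP (+ x) +P oneP ≋ constP (+ suc x)
  constP-suc = ∷-cong (ℤ.+-comm (+ x) (+ 1)) ≋-refl

coprimeOverℚ-qintPow-qint : ∀ g h → CoprimeOverℚ (qintPow g (suc h)) (qint g)
coprimeOverℚ-qintPow-qint g h = bezout oneP (-P Z) (+ suc h) (λ ()) (begin
  oneP *P K +P (-P Z) *P qint g                         ≈⟨ +P-cong (*P-identityˡ K) ≋-refl ⟩
  K +P (-P Z) *P qint g                                 ≈⟨ +P-cong K≋h+GZ ≋-refl ⟩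
  (constP (+ suc h) +P qint g *P Z) +P (-P Z) *P qint g ≈⟨ cancel (constP (+ suc h)) (qint g) Z ⟩
  constP (+ suc h)                                      ∎)
  where
  open ≋-Reasoning
  K : Poly
  K = qintPow g (suc h)
  Z : Poly
  Z = proj₁ (qintPow≡const-mod-qint g (suc h))
  K≋h+GZ : K ≋ constP (+ suc h) +P qint g *P Z
  K≋h+GZ = proj₂ (qintPow≡const-mod-qint g (suc h))
  cancel : ∀ c G Z → (c +P G *P Z) +P (-P Z) *P G ≋ c
  cancel = solve-∀ Poly-almostCommutativeRing

qint-∸ : ∀ d s {t} → d + s ≡ t → qint d ≋ qint t +P -P (monoP d *P qint s)
qint-∸ d s refl = ≋-trans (unshift (qint d) (monoP d *P qint s)) (+P-cong (≋-sym (≋-trans (qintPow-+ 1 d s)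
  (≡⇒≋ (cong (λ e → qint d +P monoP e *P qint s) (ℕ.*-identityˡ d))))) ≋-refl)
  where
  unshift : ∀ a b → a ≋ (a +P b) +P -P b
  unshift = solve-∀ Poly-almostCommutativeRing

qint-*ʳ : ∀ x a → qint (x * a) ≋ qintPow a x *P qint a
qint-*ʳ x a = ≋-trans (≡⇒≋ (cong qint (ℕ.*-comm x a))) (≋-trans (qint-* a x) (*P-comm (qint a) (qintPow a x)))

-- From d + y b = x a in ℕ (or its mirror image) and [x a] = [d] + q^d [y b].
qint-bezout : ∀ a b → ∃₂ λ U V → U *P qint a +P V *P qint b ≋ qint (gcd a b)
qint-bezout a b with Bézout.identity (gcd-GCD a b)
... | Bézout.+- x y d+yb≡xa = qintPow a x , -P (monoP (gcd a b) *P qintPow b y) , ≋-sym (begin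
  qint (gcd a b)                                        ≈⟨ qint-∸ (gcd a b) (y * b) d+yb≡xa ⟩
  qint (x * a) +P -P (monoP (gcd a b) *P qint (y * b))  ≈⟨ +P-cong (qint-*ʳ x a) (-P-cong (*P-congʳ (monoP (gcd a b)) (qint-*ʳ y b))) ⟩
  qintPow a x *P qint a +P -P (monoP (gcd a b) *P (qintPow b y *P qint b))
                                                        ≈⟨ regroup (qintPow a x) (qint a) (monoP (gcd a b)) (qintPow b y) (qint b) ⟩
  qintPow a x *P qint a +P -P (monoP (gcd a b) *P qintPow b y) *P qint b ∎)
  where
  open ≋-Reasoning
  regroup : ∀ u A m v B → u *P A +P -P (m *P (v *P B)) ≋ u *P A +P -P (m *P v) *P B
  regroup = solve-∀ Poly-almostCommutativeRing
... | Bézout.-+ x y d+xa≡yb = -P (monoP (gcd a b) *P qintPow a x) , qintPow b y , ≋-sym (begin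
  qint (gcd a b)                                        ≈⟨ qint-∸ (gcd a b) (x * a) d+xa≡yb ⟩
  qint (y * b) +P -P (monoP (gcd a b) *P qint (x * a))  ≈⟨ +P-cong (qint-*ʳ y b) (-P-cong (*P-congʳ (monoP (gcd a b)) (qint-*ʳ x a))) ⟩
  qintPow b y *P qint b +P -P (monoP (gcd a b) *P (qintPow a x *P qint a))
                                                        ≈⟨ regroup (qintPow b y) (qint b) (monoP (gcd a b)) (qintPow a x) (qint a) ⟩
  -P (monoP (gcd a b) *P qintPow a x) *P qint a +P qintPow b y *P qint b ∎)
  where
  open ≋-Reasoning
  regroup : ∀ v B m u A → v *P B +P -P (m *P (u *P A)) ≋ -P (m *P u) *P A +P v *P B
  regroup = solve-∀ Poly-almostCommutativeRing

-- Cyclotomic factorisation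

infixr 8 _^P_
_^P_ : Poly → ℕ → Poly
p ^P zero  = oneP
p ^P suc n = p *P p ^P n

^P-+ : ∀ p a b → p ^P (a + b) ≋ p ^P a *P p ^P b
^P-+ p zero    b = ≋-sym (*P-identityˡ (p ^P b))
^P-+ p (suc a) b = ≋-trans (*P-congʳ p (^P-+ p a b)) (≋-sym (*P-assoc p (p ^P a) (p ^P b)))

prodTo : ℕ → (ℕ → Poly) → Poly
prodTo zero    F = oneP
prodTo (suc t) F = prodTo t F *P F (suc t)

prodTo-cong : ∀ t {F G} → (∀ f → 1 ≤ f → f ≤ t → F f ≋ G f) → prodTo t F ≋ prodTo t G
prodTo-cong zero    F≋G = ≋-refl
prodTo-cong (suc t) F≋G = *P-cong (prodTo-cong t λ f 1≤f f≤t → F≋G f 1≤f (ℕ.m≤n⇒m≤1+n f≤t))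
  (F≋G (suc t) (s≤s z≤n) ℕ.≤-refl)

prodTo-∣P : ∀ t {F G} → (∀ f → 1 ≤ f → f ≤ t → F f ∣P G f) → prodTo t F ∣P prodTo t G
prodTo-∣P zero    F∣G = ∣P-refl oneP
prodTo-∣P (suc t) F∣G = ∣P-*P (prodTo-∣P t λ f 1≤f f≤t → F∣G f 1≤f (ℕ.m≤n⇒m≤1+n f≤t))
  (F∣G (suc t) (s≤s z≤n) ℕ.≤-refl)

prodTo-*P : ∀ t F G → prodTo t (λ f → F f *P G f) ≋ prodTo t F *P prodTo t G
prodTo-*P zero    F G = ≋-sym (*P-identityˡ oneP)
prodTo-*P (suc t) F G = ≋-trans (*P-congˡ (F (suc t) *P G (suc t)) (prodTo-*P t F G))
  (interchange (prodTo t F) (prodTo t G) (F (suc t)) (G (suc t)))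
  where
  interchange : ∀ a b c d → (a *P b) *P (c *P d) ≋ (a *P c) *P (b *P d)
  interchange = solve-∀ Poly-almostCommutativeRing

prodTo-extend : ∀ {t u F} → t ≤ u → (∀ f → t < f → f ≤ u → F f ≋ oneP) → prodTo u F ≋ prodTo t F
prodTo-extend {t} {zero}  z≤n F≡1 = ≋-refl
prodTo-extend {t} {suc u} t≤u F≡1 with t ℕ.≟ suc u
... | yes refl = ≋-refl
... | no  t≢u  = ≋-trans (*P-cong (prodTo-extend t≤u' λ f t<f f≤u → F≡1 f t<f (ℕ.m≤n⇒m≤1+n f≤u))
                                  (F≡1 (suc u) (s≤s t≤u') ℕ.≤-refl)) (*P-identityʳ _)
  where
  t≤u' : t ≤ u
  t≤u' = ℕ.≤-pred (ℕ.≤∧≢⇒< t≤u t≢u)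

constantTermOne-^P : ∀ {p} n → ConstantTermOne p → ConstantTermOne (p ^P n)
constantTermOne-^P zero    p₁ = constantTermOne-oneP
constantTermOne-^P (suc n) p₁ = constantTermOne-*P p₁ (constantTermOne-^P n p₁)

constantTermOne-prodTo : ∀ t {F} → (∀ f → ConstantTermOne (F f)) → ConstantTermOne (prodTo t F)
constantTermOne-prodTo zero    F₁ = constantTermOne-oneP
constantTermOne-prodTo (suc t) F₁ = constantTermOne-*P (constantTermOne-prodTo t F₁) (F₁ (suc t))

coprimeOverℚ-^P : ∀ {A B} n → CoprimeOverℚ A B → CoprimeOverℚ A (B ^P n)
coprimeOverℚ-^P {A} zero    A⊥B = coprimeOverℚ-oneʳ A
coprimeOverℚ-^P (suc n) A⊥B = coprimeOverℚ-*P A⊥B (coprimeOverℚ-^P n A⊥B)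

coprimeOverℚ-prodTo : ∀ {A} t {F} → (∀ f → 1 ≤ f → f ≤ t → CoprimeOverℚ A (F f)) → CoprimeOverℚ A (prodTo t F)
coprimeOverℚ-prodTo {A} zero    A⊥F = coprimeOverℚ-oneʳ A
coprimeOverℚ-prodTo (suc t) A⊥F = coprimeOverℚ-*P (coprimeOverℚ-prodTo t λ f 1≤f f≤t → A⊥F f 1≤f (ℕ.m≤n⇒m≤1+n f≤t))
                                                  (A⊥F (suc t) (s≤s z≤n) ℕ.≤-refl)

countMultiples : ℕ → List ℕ → ℕ
countMultiples f []      = 0
countMultiples f (a ∷ S) with f ∣? a
... | yes _ = suc (countMultiples f S)
... | no  _ = countMultiples f S

countMultiples-∣ : ∀ {f e} → f ∣ e → countMultiples f (e ∷ []) ≡ 1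
countMultiples-∣ {f} {e} f∣e with f ∣? e
... | yes _   = refl
... | no  f∤e = ⊥-elim (f∤e f∣e)

countMultiples-∤ : ∀ {f e} → ¬ f ∣ e → countMultiples f (e ∷ []) ≡ 0
countMultiples-∤ {f} {e} f∤e with f ∣? e
... | yes f∣e = ⊥-elim (f∤e f∣e)
... | no  _   = refl

countMultiples-∷ : ∀ f a S → countMultiples f (a ∷ S) ≡ countMultiples f (a ∷ []) + countMultiples f S
countMultiples-∷ f a S with f ∣? a
... | yes _ = refl
... | no  _ = refl

^P-divisor : ∀ p {f e} → f ∣ e → p ^P countMultiples f (e ∷ []) ≋ p
^P-divisor p f∣e = ≋-trans (≡⇒≋ (cong (p ^P_) (countMultiples-∣ f∣e))) (*P-identityʳ p)

^P-nondivisor : ∀ p {f e} → ¬ f ∣ e → p ^P countMultiples f (e ∷ []) ≋ oneP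
^P-nondivisor p f∤e = ≡⇒≋ (cong (p ^P_) (countMultiples-∤ f∤e))

^P-divisor-∣P : ∀ p f {g e} → g ∣ e → p ^P countMultiples f (g ∷ []) ∣P p ^P countMultiples f (e ∷ [])
^P-divisor-∣P p f {g} {e} g∣e = by-cases (f ∣? g)
  where
  by-cases : Dec (f ∣ g) → p ^P countMultiples f (g ∷ []) ∣P p ^P countMultiples f (e ∷ [])
  by-cases (yes f∣g) = ∣P-respˡ (≋-sym (^P-divisor p f∣g)) (∣P-respʳ (≋-sym (^P-divisor p (∣-trans f∣g g∣e))) (∣P-refl p))
  by-cases (no  f∤g) = ∣P-respˡ (≋-sym (^P-nondivisor p f∤g)) (oneP-∣P _)

-- The exponent countMultiples f (e ∷ []) is 1 if f ∣ e and 0 otherwise.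
prodDivisors : (ℕ → Poly) → ℕ → ℕ → Poly
prodDivisors Φ e t = prodTo t λ f → Φ f ^P countMultiples f (e ∷ [])

record Cyclotomic (M : ℕ) (Φ : ℕ → Poly) : Set where
  field
    constantTermOne-Φ : ∀ f → ConstantTermOne (Φ f)
    qint≋prodDivisors : ∀ e → 1 ≤ e → e ≤ M → qint e ≋ prodDivisors Φ e e

module _ {M Φ} (cyclotomic : Cyclotomic M Φ) where
  open Cyclotomic cyclotomic

  qint≋prodDivisors-extend : ∀ {e t} → 1 ≤ e → e ≤ t → e ≤ M → qint e ≋ prodDivisors Φ e t
  qint≋prodDivisors-extend 1≤e e≤t e≤M = ≋-trans (qint≋prodDivisors _ 1≤e e≤M)
    (≋-sym (prodTo-extend e≤t λ f e<f _ → ^P-nondivisor (Φ f) (>⇒∤ {{ℕ.>-nonZero 1≤e}} e<f)))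

  qint≋prodProperDivisors*Φ : ∀ e → suc e ≤ M → qint (suc e) ≋ prodDivisors Φ (suc e) e *P Φ (suc e)
  qint≋prodProperDivisors*Φ e e<M = ≋-trans (qint≋prodDivisors (suc e) (s≤s z≤n) e<M)
    (*P-congʳ (prodDivisors Φ (suc e) e) (^P-divisor (Φ (suc e)) (∣-refl {suc e})))

  Φ∣qint : ∀ e → 1 ≤ e → e ≤ M → Φ e ∣P qint e
  Φ∣qint (suc e) _ e<M = prodDivisors Φ (suc e) e , ≋-sym (qint≋prodProperDivisors*Φ e e<M)

  -- With g = gcd e f < e: [g] divides the cofactor of Φ e in [e] = [e/g]_{q^g} [g], while
  -- [e/g]_{q^g} ≡ e/g modulo [g]; and [g] is a combination of [e] and [f].
  private
    coprimeOverℚ-Φ-qint-viaGcd : ∀ {e f} g → g ∣ e → g ∣ f → g ≢ 0 → 1 ≤ e → e ≤ M → ¬ e ∣ f →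
                                 (∃ λ U → ∃ λ V → U *P qint e +P V *P qint f ≋ qint g) →
                                 CoprimeOverℚ (Φ e) (qint f)
    coprimeOverℚ-Φ-qint-viaGcd zero _ _ g≢0 = ⊥-elim (g≢0 refl)
    coprimeOverℚ-Φ-qint-viaGcd (suc g) (divides zero refl) _ _ ()
    coprimeOverℚ-Φ-qint-viaGcd {f = f} (suc g) g∣e@(divides (suc h) refl) g∣f _ _ e≤M e∤f (U , V , U[e]+V[f]≋[g]) =
      coprimeOverℚ-combination (U *P R) V [g]≋URΦ+V[f] (coprimeOverℚ-∣ˡ (Y , ≋-sym K≋YΦ) (coprimeOverℚ-qintPow-qint (suc g) h))
      where
      open ≋-Reasoning
      e' : ℕ
      e' = g + h * suc g
      K : Poly
      K = qintPow (suc g) (suc h)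
      R : Poly
      R = prodDivisors Φ (suc e') e'
      [e]≋RΦ : qint (suc e') ≋ R *P Φ (suc e')
      [e]≋RΦ = qint≋prodProperDivisors*Φ e' e≤M
      g<e : suc g ≤ e'
      g<e = ℕ.≤-pred (ℕ.≤∧≢⇒< (∣⇒≤ g∣e) λ g≡e → e∤f (subst (_∣ f) g≡e g∣f))
      [g]∣R : qint (suc g) ∣P R
      [g]∣R = ∣P-respˡ (≋-sym (qint≋prodDivisors-extend (s≤s z≤n) g<e (ℕ.≤-trans (ℕ.m≤n⇒m≤1+n g<e) e≤M)))
                (prodTo-∣P e' λ f' _ _ → ^P-divisor-∣P (Φ f') f' g∣e)
      Y : Poly
      Y = proj₁ [g]∣R
      K≋YΦ : K ≋ Y *P Φ (suc e')
      K≋YΦ = *P-cancelʳ (constantTermOne-qint g) K (Y *P Φ (suc e')) (begin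
        K *P qint (suc g)                  ≈⟨ qint-*ʳ (suc h) (suc g) ⟨
        qint (suc e')                      ≈⟨ [e]≋RΦ ⟩
        R *P Φ (suc e')                    ≈⟨ *P-congˡ (Φ (suc e')) (proj₂ [g]∣R) ⟨
        (Y *P qint (suc g)) *P Φ (suc e')  ≈⟨ swap Y (qint (suc g)) (Φ (suc e')) ⟩
        (Y *P Φ (suc e')) *P qint (suc g)  ∎)
        where
        swap : ∀ a b c → (a *P b) *P c ≋ (a *P c) *P b
        swap = solve-∀ Poly-almostCommutativeRing
      [g]≋URΦ+V[f] : qint (suc g) ≋ (U *P R) *P Φ (suc e') +P V *P qint f
      [g]≋URΦ+V[f] = ≋-trans (≋-sym U[e]+V[f]≋[g])
        (+P-cong (≋-trans (*P-congʳ U [e]≋RΦ) (≋-sym (*P-assoc U R (Φ (suc e'))))) ≋-refl)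

  coprimeOverℚ-Φ-qint : ∀ {e f} → 1 ≤ e → e ≤ M → 1 ≤ f → ¬ e ∣ f → CoprimeOverℚ (Φ e) (qint f)
  coprimeOverℚ-Φ-qint {e} {f} 1≤e e≤M 1≤f e∤f = coprimeOverℚ-Φ-qint-viaGcd (gcd e f) (gcd[m,n]∣m e f) (gcd[m,n]∣n e f)
    (gcd[m,n]≢0 e f (inj₂ (ℕ.≢-nonZero⁻¹ f {{ℕ.>-nonZero 1≤f}}))) 1≤e e≤M e∤f (qint-bezout e f)

  coprimeOverℚ-Φ-Φ : ∀ {e f} → 1 ≤ f → f < e → e ≤ M → CoprimeOverℚ (Φ e) (Φ f)
  coprimeOverℚ-Φ-Φ 1≤f f<e e≤M = coprimeOverℚ-∣ʳ (Φ∣qint _ 1≤f (ℕ.≤-trans (ℕ.<⇒≤ f<e) e≤M))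
    (coprimeOverℚ-Φ-qint (ℕ.≤-trans 1≤f (ℕ.<⇒≤ f<e)) e≤M 1≤f (>⇒∤ {{ℕ.>-nonZero 1≤f}} f<e))

  constantTermOne-prodDivisors : ∀ n t → ConstantTermOne (prodDivisors Φ n t)
  constantTermOne-prodDivisors n t = constantTermOne-prodTo t λ f → constantTermOne-^P (countMultiples f (n ∷ [])) (constantTermOne-Φ f)

  -- The Φ f with f ∣ n are pairwise coprime divisors of [n].
  prodDivisors-∣P-qint : ∀ n t → t ≤ M → prodDivisors Φ n t ∣P qint n
  prodDivisors-∣P-qint n zero    _   = oneP-∣P (qint n)
  prodDivisors-∣P-qint n (suc t) t<M = by-cases (suc t ∣? n)
    where
    P : Poly
    P = prodDivisors Φ n t
    P∣[n] : P ∣P qint n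
    P∣[n] = prodDivisors-∣P-qint n t (ℕ.<⇒≤ t<M)
    by-cases : Dec (suc t ∣ n) → P *P Φ (suc t) ^P countMultiples (suc t) (n ∷ []) ∣P qint n
    by-cases (yes t+1∣n) = ∣P-respˡ (*P-congʳ P (≋-sym (^P-divisor (Φ (suc t)) t+1∣n)))
      (coprimeOverℚ⇒*P-∣P P⊥Φ (constantTermOne-prodDivisors n t) (constantTermOne-Φ (suc t))
        P∣[n] (∣P-trans (Φ∣qint (suc t) (s≤s z≤n) t<M) (qint-∣ t+1∣n)))
      where
      P⊥Φ : CoprimeOverℚ P (Φ (suc t))
      P⊥Φ = coprimeOverℚ-sym (coprimeOverℚ-prodTo t λ f 1≤f f≤t →
        coprimeOverℚ-^P (countMultiples f (n ∷ [])) (coprimeOverℚ-Φ-Φ 1≤f (s≤s f≤t) t<M))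
    by-cases (no t+1∤n) = ∣P-respˡ (≋-trans (≋-sym (*P-identityʳ P)) (*P-congʳ P (≋-sym (^P-nondivisor (Φ (suc t)) t+1∤n)))) P∣[n]

update : (ℕ → Poly) → ℕ → Poly → ℕ → Poly
update Φ n X f with f ≟ n
... | yes _ = X
... | no  _ = Φ f

update-≡ : ∀ Φ n X → update Φ n X n ≡ X
update-≡ Φ n X with n ≟ n
... | yes _   = refl
... | no  n≢n = ⊥-elim (n≢n refl)

update-≢ : ∀ Φ {n} X {f} → f ≢ n → update Φ n X f ≡ Φ f
update-≢ Φ {n} X {f} f≢n with f ≟ n
... | yes f≡n = ⊥-elim (f≢n f≡n)
... | no  _   = refl

constantTermOne-update : ∀ {Φ n X} → ConstantTermOne X → (∀ f → ConstantTermOne (Φ f)) →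
                         ∀ f → ConstantTermOne (update Φ n X f)
constantTermOne-update {Φ} {n} {X} X₁ Φ₁ f with f ≟ n
... | yes _ = X₁
... | no  _ = Φ₁ f

cyclotomic-extend : ∀ {M Φ X} → Cyclotomic M Φ → X *P prodDivisors Φ (suc M) M ≋ qint (suc M) →
                    Cyclotomic (suc M) (update Φ (suc M) X)
cyclotomic-extend {M} {Φ} {X} cyclotomic XP≋[M+1] = record
  { constantTermOne-Φ = constantTermOne-update
      (constantTermOne-quotient XP≋[M+1] (constantTermOne-prodDivisors cyclotomic (suc M) M) (constantTermOne-qint M))
      constantTermOne-Φ
  ; qint≋prodDivisors = qint≋prodDivisors' }
  where
  open Cyclotomic cyclotomic
  Φ' : ℕ → Poly
  Φ' = update Φ (suc M) X
  P : Poly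
  P = prodDivisors Φ (suc M) M
  prodDivisors-Φ'≋Φ : ∀ n t → t ≤ M → prodDivisors Φ' n t ≋ prodDivisors Φ n t
  prodDivisors-Φ'≋Φ n t t≤M = prodTo-cong t λ f _ f≤t →
    ≡⇒≋ (cong (_^P countMultiples f (n ∷ [])) (update-≢ Φ X (ℕ.<⇒≢ (s≤s (ℕ.≤-trans f≤t t≤M)))))
  qint≋prodDivisors' : ∀ e → 1 ≤ e → e ≤ suc M → qint e ≋ prodDivisors Φ' e e
  qint≋prodDivisors' e 1≤e e≤M+1 with ℕ.m≤n⇒m<n∨m≡n e≤M+1
  ... | inj₁ e<M+1 = ≋-trans (qint≋prodDivisors e 1≤e (ℕ.≤-pred e<M+1)) (≋-sym (prodDivisors-Φ'≋Φ e e (ℕ.≤-pred e<M+1)))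
  ... | inj₂ refl  = ≋-sym (begin
    prodDivisors Φ' (suc M) M *P Φ' (suc M) ^P countMultiples (suc M) (suc M ∷ [])
      ≈⟨ *P-cong (prodDivisors-Φ'≋Φ (suc M) M ℕ.≤-refl) (^P-divisor (Φ' (suc M)) (∣-refl {suc M})) ⟩
    P *P Φ' (suc M)   ≡⟨ cong (P *P_) (update-≡ Φ (suc M) X) ⟩
    P *P X            ≈⟨ *P-comm P X ⟩
    X *P P            ≈⟨ XP≋[M+1] ⟩
    qint (suc M)      ∎)
    where open ≋-Reasoning

cyclotomic : ∀ M → ∃ (Cyclotomic M)
cyclotomic zero    = (λ _ → oneP) , record
  { constantTermOne-Φ = λ _ → constantTermOne-oneP
  ; qint≋prodDivisors = λ { (suc _) _ () } }
cyclotomic (suc M) =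
  let Φ , cyc = cyclotomic M
      X , XP≋[M+1] = prodDivisors-∣P-qint cyc (suc M) M ℕ.≤-refl
  in update Φ (suc M) X , cyclotomic-extend cyc XP≋[M+1]

∏qint : List ℕ → Poly
∏qint S = prodP (map qint S)

∏qint≋prodTo-Φ : ∀ {M Φ} → Cyclotomic M Φ → ∀ {S} → All NonZero S → All (_≤ M) S →
                 ∏qint S ≋ prodTo M (λ f → Φ f ^P countMultiples f S)
∏qint≋prodTo-Φ {M} {Φ} cyc [] [] = ≋-sym (prodTo-extend {u = M} {F = λ f → Φ f ^P 0} ℕ.z≤n λ _ _ _ → ≋-refl)
∏qint≋prodTo-Φ {M} {Φ} cyc {a ∷ S} (a≢0 ∷ S≢0) (a≤M ∷ S≤M) = begin
  qint a *P ∏qint S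
    ≈⟨ *P-cong (qint≋prodDivisors-extend cyc (ℕ.>-nonZero⁻¹ a {{a≢0}}) a≤M a≤M) (∏qint≋prodTo-Φ cyc S≢0 S≤M) ⟩
  prodDivisors Φ a M *P prodTo M (λ f → Φ f ^P countMultiples f S)
    ≈⟨ prodTo-*P M (λ f → Φ f ^P countMultiples f (a ∷ [])) (λ f → Φ f ^P countMultiples f S) ⟨
  prodTo M (λ f → Φ f ^P countMultiples f (a ∷ []) *P Φ f ^P countMultiples f S)
    ≈⟨ prodTo-cong M (λ f _ _ → ≋-trans (≋-sym (^P-+ (Φ f) (countMultiples f (a ∷ [])) (countMultiples f S)))
                                         (≡⇒≋ (cong (Φ f ^P_) (sym (countMultiples-∷ f a S))))) ⟩
  prodTo M (λ f → Φ f ^P countMultiples f (a ∷ S)) ∎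
  where open ≋-Reasoning

-- In ∏_{a ∈ S} [a] the f-th cyclotomic polynomial occurs once for each multiple of f in S.
∏qint-∣P : ∀ {S T} → All NonZero S → All NonZero T →
           (∀ f → .{{NonZero f}} → countMultiples f T ≤ countMultiples f S) → ∏qint T ∣P ∏qint S
∏qint-∣P {S} {T} S≢0 T≢0 T≤S = prodTo M (λ f → Φ f ^P (countMultiples f S ∸ countMultiples f T)) , (begin
  prodTo M (λ f → Φ f ^P (c S f ∸ c T f)) *P ∏qint T
    ≈⟨ *P-congʳ (prodTo M (λ f → Φ f ^P (c S f ∸ c T f))) (∏qint≋prodTo-Φ cyc T≢0 T≤M) ⟩
  prodTo M (λ f → Φ f ^P (c S f ∸ c T f)) *P prodTo M (λ f → Φ f ^P c T f)
    ≈⟨ prodTo-*P M (λ f → Φ f ^P (c S f ∸ c T f)) (λ f → Φ f ^P c T f) ⟨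
  prodTo M (λ f → Φ f ^P (c S f ∸ c T f) *P Φ f ^P c T f)
    ≈⟨ prodTo-cong M (λ f 1≤f _ → ≋-trans (≋-sym (^P-+ (Φ f) (c S f ∸ c T f) (c T f)))
         (≡⇒≋ (cong (Φ f ^P_) (ℕ.m∸n+n≡m (T≤S f {{ℕ.>-nonZero 1≤f}}))))) ⟩
  prodTo M (λ f → Φ f ^P c S f)
    ≈⟨ ∏qint≋prodTo-Φ cyc S≢0 S≤M ⟨
  ∏qint S ∎)
  where
  open ≋-Reasoning
  c : List ℕ → ℕ → ℕ
  c U f = countMultiples f U
  M : ℕ
  M = max 0 (S ++ T)
  S≤M : All (_≤ M) S
  S≤M = proj₁ (All.++⁻ S (xs≤max 0 (S ++ T)))
  T≤M : All (_≤ M) T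
  T≤M = proj₂ (All.++⁻ S (xs≤max 0 (S ++ T)))
  Φ : ℕ → Poly
  Φ = proj₁ (cyclotomic M)
  cyc : Cyclotomic M Φ
  cyc = proj₂ (cyclotomic M)

∏qint-++ : ∀ S T → ∏qint (S ++ T) ≋ ∏qint S *P ∏qint T
∏qint-++ []      T = ≋-sym (*P-identityˡ (∏qint T))
∏qint-++ (a ∷ S) T = ≋-trans (*P-congʳ (qint a) (∏qint-++ S T)) (≋-sym (*P-assoc (qint a) (∏qint S) (∏qint T)))

constantTermOne-∏qint : ∀ {S} → All NonZero S → ConstantTermOne (∏qint S)
constantTermOne-∏qint []                        = constantTermOne-oneP
constantTermOne-∏qint {suc a ∷ S} (_ ∷ S≢0) = constantTermOne-*P (constantTermOne-qint a) (constantTermOne-∏qint S≢0)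

-- Counting multiples

-- oneTo x = [x, x - 1, …, 1], the order in which qfact x unfolds.
oneTo : ℕ → List ℕ
oneTo = applyDownFrom suc

m<[1+m/n]*n : ∀ m n .{{_ : NonZero n}} → m < suc (m / n) * n
m<[1+m/n]*n m n = begin-strict
  m                    ≡⟨ m≡m%n+[m/n]*n m n ⟩
  m % n + m / n * n    <⟨ ℕ.+-monoˡ-< (m / n * n) (m%n<n m n) ⟩
  n + m / n * n        ∎
  where open ℕ.≤-Reasoning

/-unique : ∀ {m n q} .{{_ : NonZero n}} → q * n ≤ m → m < suc q * n → m / n ≡ q
/-unique {m} {n} {q} lo hi = ℕ.≤-antisym (ℕ.≤-pred (m<n*o⇒m/o<n hi)) (begin
  q              ≡⟨ m*n/n≡m q n ⟨
  q * n / n      ≤⟨ /-monoˡ-≤ n lo ⟩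
  m / n          ∎)
  where open ℕ.≤-Reasoning

[1+m]/n≡1+m/n : ∀ {m n} .{{_ : NonZero n}} → n ∣ suc m → suc m / n ≡ suc (m / n)
[1+m]/n≡1+m/n {m} {n} (divides p 1+m≡pn) = /-unique (begin
  suc (m / n) * n   ≤⟨ ℕ.*-monoˡ-≤ n (ℕ.*-cancelʳ-< n (m / n) p (begin-strict
                         m / n * n   ≤⟨ m/n*n≤m m n ⟩
                         m           <⟨ ℕ.n<1+n m ⟩
                         suc m       ≡⟨ 1+m≡pn ⟩
                         p * n       ∎)) ⟩
  p * n             ≡⟨ 1+m≡pn ⟨
  suc m             ∎) (ℕ.≤-<-trans (m<[1+m/n]*n m n) (ℕ.m<n+m _ (ℕ.>-nonZero⁻¹ n)))
  where open ℕ.≤-Reasoning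

[1+m]/n≡m/n : ∀ {m n} .{{_ : NonZero n}} → ¬ n ∣ suc m → suc m / n ≡ m / n
[1+m]/n≡m/n {m} {n} n∤1+m = /-unique (ℕ.m≤n⇒m≤1+n (m/n*n≤m m n))
  (ℕ.≤∧≢⇒< (m<[1+m/n]*n m n) λ 1+m≡[1+m/n]n → n∤1+m (divides (suc (m / n)) 1+m≡[1+m/n]n))

countMultiples-suc : ∀ m n .{{_ : NonZero n}} → countMultiples n (suc m ∷ []) + m / n ≡ suc m / n
countMultiples-suc m n with n ∣? suc m
... | yes n∣1+m = sym ([1+m]/n≡1+m/n n∣1+m)
... | no  n∤1+m = sym ([1+m]/n≡m/n n∤1+m)

countMultiples-oneTo : ∀ m n .{{_ : NonZero n}} → countMultiples n (oneTo m) ≡ m / n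
countMultiples-oneTo zero    n = sym (0/n≡0 n)
countMultiples-oneTo (suc m) n = begin
  countMultiples n (suc m ∷ oneTo m)                     ≡⟨ countMultiples-∷ n (suc m) (oneTo m) ⟩
  countMultiples n (suc m ∷ []) + countMultiples n (oneTo m) ≡⟨ cong (_+_ (countMultiples n (suc m ∷ []))) (countMultiples-oneTo m n) ⟩
  countMultiples n (suc m ∷ []) + m / n                  ≡⟨ countMultiples-suc m n ⟩
  suc m / n                                              ∎
  where open ≡-Reasoning

m/o+n/o≤[m+n]/o : ∀ m n o .{{_ : NonZero o}} → m / o + n / o ≤ (m + n) / o
m/o+n/o≤[m+n]/o m n o = begin
  m / o + n / o             ≡⟨ m*n/n≡m (m / o + n / o) o ⟨
  (m / o + n / o) * o / o   ≤⟨ /-monoˡ-≤ o (begin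
    (m / o + n / o) * o       ≡⟨ ℕ.*-distribʳ-+ o (m / o) (n / o) ⟩
    m / o * o + n / o * o     ≤⟨ ℕ.+-mono-≤ (m/n*n≤m m o) (m/n*n≤m n o) ⟩
    m + n                     ∎) ⟩
  (m + n) / o               ∎
  where open ℕ.≤-Reasoning

[m*n+o]/[p*n]≡m/p : ∀ m n o p .{{_ : NonZero n}} .{{_ : NonZero p}} .{{_ : NonZero (p * n)}} → o < n →
                    (m * n + o) / (p * n) ≡ m / p
[m*n+o]/[p*n]≡m/p m n o p o<n = begin
  (m * n + o) / (p * n)       ≡⟨ /-congʳ (ℕ.*-comm p n) ⟩
  (m * n + o) / (n * p)       ≡⟨ m/n/o≡m/[n*o] (m * n + o) n p ⟨
  (m * n + o) / n / p         ≡⟨ cong (_/ p) (+-distrib-/-∣ˡ o (divides-refl m)) ⟩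
  (m * n / n + o / n) / p     ≡⟨ cong₂ (λ a b → (a + b) / p) (m*n/n≡m m n) (m<n⇒m/n≡0 o<n) ⟩
  (m + 0) / p                 ≡⟨ cong (_/ p) (ℕ.+-identityʳ m) ⟩
  m / p                       ∎
  where
  open ≡-Reasoning
  instance
    n*p≢0 : NonZero (n * p)
    n*p≢0 = ℕ.m*n≢0 n p

countMultiples-++ : ∀ f xs ys → countMultiples f (xs ++ ys) ≡ countMultiples f xs + countMultiples f ys
countMultiples-++ f []       ys = refl
countMultiples-++ f (x ∷ xs) ys = begin
  countMultiples f (x ∷ xs ++ ys)                                    ≡⟨ countMultiples-∷ f x (xs ++ ys) ⟩
  countMultiples f (x ∷ []) + countMultiples f (xs ++ ys)            ≡⟨ cong (_+_ (countMultiples f (x ∷ []))) (countMultiples-++ f xs ys) ⟩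
  countMultiples f (x ∷ []) + (countMultiples f xs + countMultiples f ys) ≡⟨ ℕ.+-assoc (countMultiples f (x ∷ [])) _ _ ⟨
  (countMultiples f (x ∷ []) + countMultiples f xs) + countMultiples f ys ≡⟨ cong (_+ countMultiples f ys) (countMultiples-∷ f x xs) ⟨
  countMultiples f (x ∷ xs) + countMultiples f ys                    ∎
  where open ≡-Reasoning

-- applyDownFrom (n ∸_) m lists the interval n ∸ m < j ≤ n.
countMultiples-interval : ∀ m n f .{{_ : NonZero f}} → m ≤ n →
                          countMultiples f (applyDownFrom (n ∸_) m) + (n ∸ m) / f ≡ n / f
countMultiples-interval zero    n f _   = refl
countMultiples-interval (suc m) n f m<n = begin
  countMultiples f (n ∸ m ∷ I) + j / f
    ≡⟨ cong (_+ j / f) (countMultiples-∷ f (n ∸ m) I) ⟩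
  (δ (n ∸ m) + countMultiples f I) + j / f
    ≡⟨ regroup (δ (n ∸ m)) (countMultiples f I) (j / f) ⟩
  countMultiples f I + (δ (n ∸ m) + j / f)
    ≡⟨ cong (λ x → countMultiples f I + (δ x + j / f)) n∸m≡1+j ⟩
  countMultiples f I + (δ (suc j) + j / f)
    ≡⟨ cong (_+_ (countMultiples f I)) (countMultiples-suc j f) ⟩
  countMultiples f I + suc j / f
    ≡⟨ cong (λ x → countMultiples f I + x / f) n∸m≡1+j ⟨
  countMultiples f I + (n ∸ m) / f
    ≡⟨ countMultiples-interval m n f (ℕ.<⇒≤ m<n) ⟩
  n / f ∎
  where
  open ≡-Reasoning
  I : List ℕ
  I = applyDownFrom (n ∸_) m
  j : ℕ
  j = n ∸ suc m
  δ : ℕ → ℕ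
  δ x = countMultiples f (x ∷ [])
  n∸m≡1+j : n ∸ m ≡ suc j
  n∸m≡1+j = ℕ.+-∸-assoc 1 m<n
  regroup : ∀ a b c → (a + b) + c ≡ b + (a + c)
  regroup = ℕ-solve-∀

countMultiples-interval-≥ : ∀ m n f .{{_ : NonZero f}} → m ≤ n → m / f ≤ countMultiples f (applyDownFrom (n ∸_) m)
countMultiples-interval-≥ m n f m≤n = ℕ.+-cancelʳ-≤ ((n ∸ m) / f) (m / f) _ (begin
  m / f + (n ∸ m) / f                                    ≤⟨ m/o+n/o≤[m+n]/o m (n ∸ m) f ⟩
  (m + (n ∸ m)) / f                                      ≡⟨ cong (_/ f) (ℕ.m+[n∸m]≡n m≤n) ⟩
  n / f                                                  ≡⟨ countMultiples-interval m n f m≤n ⟨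
  countMultiples f (applyDownFrom (n ∸_) m) + (n ∸ m) / f ∎)
  where open ℕ.≤-Reasoning

countMultiples-map : ∀ {f f'} g J → (∀ j → f ∣ g j → f' ∣ j) → (∀ j → f' ∣ j → f ∣ g j) →
                     countMultiples f (map g J) ≡ countMultiples f' J
countMultiples-map g []      ⇒ ⇐ = refl
countMultiples-map {f} {f'} g (j ∷ J) ⇒ ⇐ with f ∣? g j | f' ∣? j
... | yes _     | yes _     = cong suc (countMultiples-map g J ⇒ ⇐)
... | yes f∣gj  | no  f'∤j  = ⊥-elim (f'∤j (⇒ j f∣gj))
... | no  f∤gj  | yes f'∣j  = ⊥-elim (f∤gj (⇐ j f'∣j))
... | no  _     | no  _     = countMultiples-map g J ⇒ ⇐

countMultiples-map-*-coprime : ∀ {k f} → Prime k → ¬ k ∣ f → ∀ J → countMultiples f (map (_* k) J) ≡ countMultiples f J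
countMultiples-map-*-coprime {k} {f} k-prime k∤f J = countMultiples-map (_* k) J
  (λ j f∣jk → coprime-divisor f⊥k (subst (f ∣_) (ℕ.*-comm j k) f∣jk))
  (λ j f∣j → ∣m⇒∣m*n k f∣j)
  where
  f⊥k : Coprime f k
  f⊥k (d∣f , d∣k) with prime⇒irreducible k-prime d∣k
  ... | inj₁ d≡1 = d≡1
  ... | inj₂ refl = ⊥-elim (k∤f d∣f)

countMultiples-map-*-multiple : ∀ k e .{{_ : NonZero k}} → ∀ J → countMultiples (e * k) (map (_* k) J) ≡ countMultiples e J
countMultiples-map-*-multiple k e J = countMultiples-map (_* k) J (λ j → *-cancelʳ-∣ k) (λ j → *-monoˡ-∣ k)

-- The quotient

qfact≡∏qint-oneTo : ∀ x → qfact x ≡ ∏qint (oneTo x)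
qfact≡∏qint-oneTo zero    = refl
qfact≡∏qint-oneTo (suc x) = cong (qint (suc x) *P_) (qfact≡∏qint-oneTo x)

upperProd≡ : ∀ k t → upperProd k (suc t) ≡ prodP (map (λ j → qintPow j k) (oneTo t))
upperProd≡ k zero    = refl
upperProd≡ k (suc t) = cong (qintPow (suc t) k *P_) (upperProd≡ k t)

-- For m ≤ n all exponents n - s are positive, so the convention of qkZ for negative exponents is never used.
lowerProd≋ : ∀ k n m → m ≤ n → lowerProd k n m ≋ prodP (map (λ j → qintPow j k) (applyDownFrom (n ∸_) m))
lowerProd≋ k n zero    _   = ≋-refl
lowerProd≋ k n (suc s) s<n = *P-cong (≡⇒≋ (cong (qkZ k) (trans (ℤ.[+m]-[+n]≡m⊖n n s) (ℤ.⊖-≥ (ℕ.<⇒≤ s<n)))))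
                                     (lowerProd≋ k n s (ℕ.<⇒≤ s<n))

prodP-qintPow*∏qint : ∀ k J → prodP (map (λ j → qintPow j k) J) *P ∏qint J ≋ ∏qint (map (_* k) J)
prodP-qintPow*∏qint k []      = *P-identityˡ oneP
prodP-qintPow*∏qint k (j ∷ J) = ≋-trans (interchange (qintPow j k) (prodP (map (λ j → qintPow j k) J)) (qint j) (∏qint J))
  (*P-cong (≋-sym (≋-trans (qint-* j k) (*P-comm (qint j) (qintPow j k)))) (prodP-qintPow*∏qint k J))
  where
  interchange : ∀ a b c d → (a *P b) *P (c *P d) ≋ (a *P c) *P (b *P d)
  interchange = solve-∀ Poly-almostCommutativeRing

module Factors (k m n i : ℕ) where
  N r : ℕ
  N = n * k + i
  r = m * k ∸ 1

  J I : List ℕ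
  J = oneTo (m ∸ 1)
  I = applyDownFrom (n ∸_) m

  numeratorFactors : List ℕ
  numeratorFactors = oneTo N ++ (map (_* k) J ++ I)

  denominatorFactors : List ℕ
  denominatorFactors = oneTo r ++ (oneTo (N ∸ r) ++ (map (_* k) I ++ J))

  auxiliaryFactors : List ℕ
  auxiliaryFactors = J ++ I

  countMultiples-numeratorFactors : ∀ f .{{_ : NonZero f}} →
    countMultiples f numeratorFactors ≡ N / f + (countMultiples f (map (_* k) J) + countMultiples f I)
  countMultiples-numeratorFactors f = begin
    countMultiples f numeratorFactors
      ≡⟨ countMultiples-++ f (oneTo N) (map (_* k) J ++ I) ⟩
    countMultiples f (oneTo N) + countMultiples f (map (_* k) J ++ I)
      ≡⟨ cong₂ _+_ (countMultiples-oneTo N f) (countMultiples-++ f (map (_* k) J) I) ⟩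
    N / f + (countMultiples f (map (_* k) J) + countMultiples f I) ∎
    where open ≡-Reasoning

  countMultiples-denominatorFactors : ∀ f .{{_ : NonZero f}} →
    countMultiples f denominatorFactors ≡ r / f + ((N ∸ r) / f + (countMultiples f (map (_* k) I) + (m ∸ 1) / f))
  countMultiples-denominatorFactors f = begin
    countMultiples f denominatorFactors
      ≡⟨ countMultiples-++ f (oneTo r) _ ⟩
    countMultiples f (oneTo r) + countMultiples f (oneTo (N ∸ r) ++ (map (_* k) I ++ J))
      ≡⟨ cong₂ _+_ (countMultiples-oneTo r f) (countMultiples-++ f (oneTo (N ∸ r)) _) ⟩
    r / f + (countMultiples f (oneTo (N ∸ r)) + countMultiples f (map (_* k) I ++ J))
      ≡⟨ cong (_+_ (r / f)) (cong₂ _+_ (countMultiples-oneTo (N ∸ r) f) (countMultiples-++ f (map (_* k) I) J)) ⟩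
    r / f + ((N ∸ r) / f + (countMultiples f (map (_* k) I) + countMultiples f J))
      ≡⟨ cong (λ x → r / f + ((N ∸ r) / f + (countMultiples f (map (_* k) I) + x))) (countMultiples-oneTo (m ∸ 1) f) ⟩
    r / f + ((N ∸ r) / f + (countMultiples f (map (_* k) I) + (m ∸ 1) / f)) ∎
    where open ≡-Reasoning

oneTo-nonZero : ∀ x → All NonZero (oneTo x)
oneTo-nonZero zero    = []
oneTo-nonZero (suc x) = _ ∷ oneTo-nonZero x

interval-nonZero : ∀ m n → m ≤ n → All NonZero (applyDownFrom (n ∸_) m)
interval-nonZero zero    n _   = []
interval-nonZero (suc s) n s<n = ℕ.>-nonZero (ℕ.m<n⇒0<n∸m s<n) ∷ interval-nonZero s n (ℕ.<⇒≤ s<n)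

map-*-nonZero : ∀ k .{{_ : NonZero k}} {J} → All NonZero J → All NonZero (map (_* k) J)
map-*-nonZero k J≢0 = All.map⁺ (All.map (λ {j} j≢0 → ℕ.m*n≢0 j k {{j≢0}}) J≢0)

module _ (k m-1 n i : ℕ) where
  open Factors k (suc m-1) n i

  numerator*auxiliary≋ : (qfact N *P upperProd k (suc m-1)) *P ∏qint auxiliaryFactors ≋ ∏qint numeratorFactors
  numerator*auxiliary≋ = begin
    (qfact N *P U) *P ∏qint (J ++ I)
      ≈⟨ *P-congʳ (qfact N *P U) (∏qint-++ J I) ⟩
    (qfact N *P U) *P (∏qint J *P ∏qint I)
      ≈⟨ regroup (qfact N) U (∏qint J) (∏qint I) ⟩
    qfact N *P ((U *P ∏qint J) *P ∏qint I)
      ≈⟨ *P-cong (≡⇒≋ (qfact≡∏qint-oneTo N)) (*P-congˡ (∏qint I) U∏J≋∏kJ) ⟩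
    ∏qint (oneTo N) *P (∏qint (map (_* k) J) *P ∏qint I)
      ≈⟨ *P-congʳ (∏qint (oneTo N)) (∏qint-++ (map (_* k) J) I) ⟨
    ∏qint (oneTo N) *P ∏qint (map (_* k) J ++ I)
      ≈⟨ ∏qint-++ (oneTo N) (map (_* k) J ++ I) ⟨
    ∏qint numeratorFactors ∎
    where
    open ≋-Reasoning
    U : Poly
    U = upperProd k (suc m-1)
    U∏J≋∏kJ : U *P ∏qint J ≋ ∏qint (map (_* k) J)
    U∏J≋∏kJ = ≋-trans (≡⇒≋ (cong (_*P ∏qint J) (upperProd≡ k m-1))) (prodP-qintPow*∏qint k J)
    regroup : ∀ a u b c → (a *P u) *P (b *P c) ≋ a *P ((u *P b) *P c)
    regroup = solve-∀ Poly-almostCommutativeRing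

  denominator*auxiliary≋ : suc m-1 ≤ n →
    ((qfact r *P qfact (N ∸ r)) *P lowerProd k n (suc m-1)) *P ∏qint auxiliaryFactors ≋ ∏qint denominatorFactors
  denominator*auxiliary≋ m≤n = begin
    ((qfact r *P qfact (N ∸ r)) *P L) *P ∏qint (J ++ I)
      ≈⟨ *P-congʳ ((qfact r *P qfact (N ∸ r)) *P L) (∏qint-++ J I) ⟩
    ((qfact r *P qfact (N ∸ r)) *P L) *P (∏qint J *P ∏qint I)
      ≈⟨ regroup (qfact r) (qfact (N ∸ r)) L (∏qint J) (∏qint I) ⟩
    qfact r *P (qfact (N ∸ r) *P ((L *P ∏qint I) *P ∏qint J))
      ≈⟨ *P-cong (≡⇒≋ (qfact≡∏qint-oneTo r))
                 (*P-cong (≡⇒≋ (qfact≡∏qint-oneTo (N ∸ r))) (*P-congˡ (∏qint J) L∏I≋∏kI)) ⟩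
    ∏qint (oneTo r) *P (∏qint (oneTo (N ∸ r)) *P (∏qint (map (_* k) I) *P ∏qint J))
      ≈⟨ *P-congʳ (∏qint (oneTo r)) (*P-congʳ (∏qint (oneTo (N ∸ r))) (∏qint-++ (map (_* k) I) J)) ⟨
    ∏qint (oneTo r) *P (∏qint (oneTo (N ∸ r)) *P ∏qint (map (_* k) I ++ J))
      ≈⟨ *P-congʳ (∏qint (oneTo r)) (∏qint-++ (oneTo (N ∸ r)) (map (_* k) I ++ J)) ⟨
    ∏qint (oneTo r) *P ∏qint (oneTo (N ∸ r) ++ (map (_* k) I ++ J))
      ≈⟨ ∏qint-++ (oneTo r) (oneTo (N ∸ r) ++ (map (_* k) I ++ J)) ⟨
    ∏qint denominatorFactors ∎
    where
    open ≋-Reasoning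
    L : Poly
    L = lowerProd k n (suc m-1)
    L∏I≋∏kI : L *P ∏qint I ≋ ∏qint (map (_* k) I)
    L∏I≋∏kI = ≋-trans (*P-congˡ (∏qint I) (lowerProd≋ k n (suc m-1) m≤n)) (prodP-qintPow*∏qint k I)
    regroup : ∀ a b l c d → ((a *P b) *P l) *P (c *P d) ≋ a *P (b *P ((l *P d) *P c))
    regroup = solve-∀ Poly-almostCommutativeRing

module _ {k-1 m-1 n i : ℕ} where
  private
    k m : ℕ
    k = suc k-1
    m = suc m-1
  open Factors k m n i

  r≡[m-1]*k+[k-1] : r ≡ m-1 * k + k-1
  r≡[m-1]*k+[k-1] = ℕ.+-comm k-1 (m-1 * k)

  N≡r+[n-m]*k+[1+i] : m ≤ n → N ≡ r + ((n ∸ m) * k + suc i)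
  N≡r+[n-m]*k+[1+i] m≤n = begin
    n * k + i                       ≡⟨ cong (λ x → x * k + i) (ℕ.m+[n∸m]≡n m≤n) ⟨
    (m + (n ∸ m)) * k + i           ≡⟨ expand m-1 (n ∸ m) k-1 i ⟩
    r + ((n ∸ m) * k + suc i)       ∎
    where
    open ≡-Reasoning
    expand : ∀ m-1 d k-1 i → (suc m-1 + d) * suc k-1 + i ≡ (k-1 + m-1 * suc k-1) + (d * suc k-1 + suc i)
    expand = ℕ-solve-∀

  r≤N : m ≤ n → r ≤ N
  r≤N m≤n = subst (r ≤_) (sym (N≡r+[n-m]*k+[1+i] m≤n)) (ℕ.m≤m+n r _)

  countMultiples-denominator≤numerator-∤ : Prime k → m ≤ n → ∀ f .{{_ : NonZero f}} → ¬ k ∣ f →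
    countMultiples f denominatorFactors ≤ countMultiples f numeratorFactors
  countMultiples-denominator≤numerator-∤ k-prime m≤n f k∤f = begin
    countMultiples f denominatorFactors
      ≡⟨ countMultiples-denominatorFactors f ⟩
    r / f + ((N ∸ r) / f + (countMultiples f (map (_* k) I) + m-1 / f))
      ≡⟨ cong (λ x → r / f + ((N ∸ r) / f + (x + m-1 / f))) (countMultiples-map-*-coprime k-prime k∤f I) ⟩
    r / f + ((N ∸ r) / f + (countMultiples f I + m-1 / f))
      ≡⟨ regroup (r / f) ((N ∸ r) / f) (countMultiples f I) (m-1 / f) ⟩
    (r / f + (N ∸ r) / f) + (m-1 / f + countMultiples f I)
      ≤⟨ ℕ.+-monoˡ-≤ _ (m/o+n/o≤[m+n]/o r (N ∸ r) f) ⟩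
    (r + (N ∸ r)) / f + (m-1 / f + countMultiples f I)
      ≡⟨ cong₂ (λ x y → x / f + (y + countMultiples f I)) (ℕ.m+[n∸m]≡n (r≤N m≤n))
              (trans (sym (countMultiples-oneTo m-1 f)) (sym (countMultiples-map-*-coprime k-prime k∤f J))) ⟩
    N / f + (countMultiples f (map (_* k) J) + countMultiples f I)
      ≡⟨ countMultiples-numeratorFactors f ⟨
    countMultiples f numeratorFactors ∎
    where
    open ℕ.≤-Reasoning
    regroup : ∀ a b c d → a + (b + (c + d)) ≡ (a + b) + (d + c)
    regroup = ℕ-solve-∀

  countMultiples-denominator≤numerator-multiple : suc i < k → m ≤ n → ∀ e .{{_ : NonZero (e * k)}} →
    countMultiples (e * k) denominatorFactors ≤ countMultiples (e * k) numeratorFactors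
  countMultiples-denominator≤numerator-multiple 1+i<k m≤n e = begin
    countMultiples (e * k) denominatorFactors
      ≡⟨ countMultiples-denominatorFactors (e * k) ⟩
    r / (e * k) + ((N ∸ r) / (e * k) + (countMultiples (e * k) (map (_* k) I) + m-1 / (e * k)))
      ≡⟨ cong₂ _+_ r/ek≡[m-1]/e (cong₂ _+_ [N∸r]/ek≡[n∸m]/e
           (cong (λ x → x + m-1 / (e * k)) (countMultiples-map-*-multiple k e I))) ⟩
    m-1 / e + ((n ∸ m) / e + (countMultiples e I + m-1 / (e * k)))
      ≡⟨ regroup (m-1 / e) ((n ∸ m) / e) (countMultiples e I) (m-1 / (e * k)) ⟩
    m-1 / e + ((countMultiples e I + (n ∸ m) / e) + m-1 / (e * k))
      ≡⟨ cong (λ x → m-1 / e + (x + m-1 / (e * k))) (countMultiples-interval m n e m≤n) ⟩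
    m-1 / e + (n / e + m-1 / (e * k))
      ≤⟨ ℕ.+-monoʳ-≤ (m-1 / e) (ℕ.+-monoʳ-≤ (n / e)
           (ℕ.≤-trans (/-monoˡ-≤ (e * k) (ℕ.n≤1+n m-1)) (countMultiples-interval-≥ m n (e * k) m≤n))) ⟩
    m-1 / e + (n / e + countMultiples (e * k) I)
      ≡⟨ ℕ.+-assoc (m-1 / e) _ _ ⟨
    (m-1 / e + n / e) + countMultiples (e * k) I
      ≡⟨ cong₂ (λ x y → x + y + countMultiples (e * k) I) (sym (trans (countMultiples-map-*-multiple k e J) (countMultiples-oneTo m-1 e)))
                (sym N/ek≡n/e) ⟩
    (countMultiples (e * k) (map (_* k) J) + N / (e * k)) + countMultiples (e * k) I
      ≡⟨ swap (countMultiples (e * k) (map (_* k) J)) (N / (e * k)) (countMultiples (e * k) I) ⟩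
    N / (e * k) + (countMultiples (e * k) (map (_* k) J) + countMultiples (e * k) I)
      ≡⟨ countMultiples-numeratorFactors (e * k) ⟨
    countMultiples (e * k) numeratorFactors ∎
    where
    open ℕ.≤-Reasoning
    instance
      e≢0 : NonZero e
      e≢0 = ℕ.m*n≢0⇒m≢0 e
    r/ek≡[m-1]/e : r / (e * k) ≡ m-1 / e
    r/ek≡[m-1]/e = trans (cong (_/ (e * k)) r≡[m-1]*k+[k-1]) ([m*n+o]/[p*n]≡m/p m-1 k k-1 e (ℕ.n<1+n k-1))
    [N∸r]/ek≡[n∸m]/e : (N ∸ r) / (e * k) ≡ (n ∸ m) / e
    [N∸r]/ek≡[n∸m]/e = trans (cong (λ x → (x ∸ r) / (e * k)) (N≡r+[n-m]*k+[1+i] m≤n))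
      (trans (cong (_/ (e * k)) (ℕ.m+n∸m≡n r ((n ∸ m) * k + suc i))) ([m*n+o]/[p*n]≡m/p (n ∸ m) k (suc i) e 1+i<k))
    N/ek≡n/e : N / (e * k) ≡ n / e
    N/ek≡n/e = [m*n+o]/[p*n]≡m/p n k i e (ℕ.<-trans (ℕ.n<1+n i) 1+i<k)
    regroup : ∀ a b c d → a + (b + (c + d)) ≡ a + ((c + b) + d)
    regroup = ℕ-solve-∀
    swap : ∀ a b c → (a + b) + c ≡ b + (a + c)
    swap = ℕ-solve-∀

  countMultiples-denominator≤numerator : Prime k → suc i < k → m ≤ n →
    ∀ f .{{_ : NonZero f}} → countMultiples f denominatorFactors ≤ countMultiples f numeratorFactors
  countMultiples-denominator≤numerator k-prime 1+i<k m≤n f with k ∣? f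
  ... | no  k∤f              = countMultiples-denominator≤numerator-∤ k-prime m≤n f k∤f
  ... | yes (divides e refl) = countMultiples-denominator≤numerator-multiple 1+i<k m≤n e

qbinom-denominator-∣P : ∀ {k} → Prime k → ∀ {i} → suc i < k → ∀ {m n} → 1 ≤ m → m ≤ n →
  (qfact (m * k ∸ 1) *P qfact (n * k + i ∸ (m * k ∸ 1))) *P lowerProd k n m ∣P qfact (n * k + i) *P upperProd k m
qbinom-denominator-∣P {zero} ()
qbinom-denominator-∣P {suc k-1} k-prime {i} 1+i<k {suc m-1} {n} _ m≤n =
  ∣P-cancelʳ (constantTermOne-∏qint (All.++⁺ J≢0 I≢0))
    (∣P-respˡ (≋-sym (denominator*auxiliary≋ k m-1 n i m≤n))
      (∣P-respʳ (≋-sym (numerator*auxiliary≋ k m-1 n i))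
        (∏qint-∣P numerator≢0 denominator≢0 (countMultiples-denominator≤numerator k-prime 1+i<k m≤n))))
  where
  k : ℕ
  k = suc k-1
  open Factors k (suc m-1) n i
  J≢0 : All NonZero J
  J≢0 = oneTo-nonZero m-1
  I≢0 : All NonZero I
  I≢0 = interval-nonZero (suc m-1) n m≤n
  numerator≢0 : All NonZero numeratorFactors
  numerator≢0 = All.++⁺ (oneTo-nonZero N) (All.++⁺ (map-*-nonZero k J≢0) I≢0)
  denominator≢0 : All NonZero denominatorFactors
  denominator≢0 = All.++⁺ (oneTo-nonZero r) (All.++⁺ (oneTo-nonZero (N ∸ r)) (All.++⁺ (map-*-nonZero k I≢0) J≢0))

m*k∸1≤n*k+i⇒m≤n : ∀ {k i m n} → suc i < k → m * k ∸ 1 ≤ n * k + i → m ≤ n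
m*k∸1≤n*k+i⇒m≤n {suc k-1} {i} {m} {n} 1+i<k r≤N with m ℕ.≤? n
... | yes m≤n = m≤n
... | no  m≰n = ⊥-elim (ℕ.<⇒≱ N<r r≤N)
  where
  N<r : n * suc k-1 + i < m * suc k-1 ∸ 1
  N<r = begin-strict
    n * suc k-1 + i          <⟨ ℕ.+-monoʳ-< (n * suc k-1) (ℕ.≤-pred 1+i<k) ⟩
    n * suc k-1 + k-1        ≡⟨ ℕ.+-comm (n * suc k-1) k-1 ⟩
    suc n * suc k-1 ∸ 1      ≤⟨ ℕ.∸-monoˡ-≤ 1 (ℕ.*-monoˡ-≤ (suc k-1) (ℕ.≰⇒> m≰n)) ⟩
    m * suc k-1 ∸ 1          ∎
    where open ℕ.≤-Reasoning

∣P⇒IsPolyQuotient : ∀ {A B} → A ∣P B → IsPolyQuotient B A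
∣P⇒IsPolyQuotient (X , XA≋B) = X , coeff-≡ XA≋B

lemma2p3 : (k : ℕ) → Prime k → (i : ℕ) → i + 2 ≤ k →
    (n m : ℕ) → 1 ≤ m →
    IsPolyQuotient (qbinomNum (n * k + i) (m * k ∸ 1) *P upperProd k m)
                   (qbinomDen (n * k + i) (m * k ∸ 1) *P lowerProd k n m)
-- This is the test by which qbinomNum and qbinomDen are defined, so both compute in each branch.
lemma2p3 k k-prime i i+2≤k n m 1≤m with m * k ∸ 1 ℕ.≤? n * k + i
... | no  _   = [] , λ _ → refl
... | yes r≤N = ∣P⇒IsPolyQuotient (qbinom-denominator-∣P k-prime 1+i<k 1≤m (m*k∸1≤n*k+i⇒m≤n 1+i<k r≤N))
  where
  1+i<k : suc i < k
  1+i<k = subst (_≤ k) (ℕ.+-comm i 2) i+2≤k
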